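{- Let $B_n^+$ be the subgroup of even elements of $B_n$ (those with $(-1)^{\ell(\sigma)}=1$, $\ell$ the Coxeter length), $D_n$ the subgroup of elements with even $\mathrm{neg}$, and $C_2\wr A_n$ the subgroup of $\sigma\in B_n$ with $\mathrm{sign}(|\sigma|)=1$. Then $$\sum_{\sigma\in B_n^+} q^{\mathrm{fmaj}(\sigma)} = \tfrac12\big([2]_q[4]_q\cdots[2n]_q + [2]_{ -q}[4]_q\cdots[2n]_{(-1)^n q}\big),$$ $$\sum_{\sigma\in D_n} q^{\mathrm{fmaj}(\sigma)} = \tfrac12\big([2]_q[4]_q\cdots[2n]_q + [2]_{ -q}[4]_{ -q}\cdots[2n]_{ -q}\big),$$ $$\sum_{\sigma\in C_2\wr A_n} q^{\mathrm{fmaj}(\sigma)} = \tfrac12\big([2]_q[4]_q\cdots[2n]_q + [2]_{q}[4]_{ -q}\cdots[2n]_{(-1)^{n-1} q}\big).$$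
   Context: $B_n$ is the group of signed permutations of $[n]$ with Coxeter generators $s_0=[-1,2,\dots,n]$, $s_i=[1,\dots,i+1,i,\dots,n]$. $[n]_q=(1-q^n)/(1-q)$. $\mathrm{neg}(\sigma)=\#\{i:\sigma(i)<0\}$; $\mathrm{sign}(|\sigma|)$ is the sign of $(|\sigma(1)|,\dots,|\sigma(n)|)\in S_n$; $\mathrm{fmaj}(\sigma)=2\,\mathrm{maj}(\sigma)+\mathrm{neg}(\sigma)$ with $\mathrm{maj}$ the major index of $(\sigma(1),\dots,\sigma(n))$ with respect to the order $-1<\cdots<-n<1<\cdots<n$. -}

module Defs where

open import Data.Bool using (Bool; true; false; if_then_else_)
open import Data.Nat as ℕ using (ℕ; zero; suc; _<_; _≤_)
import Data.Nat.Properties as ℕP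
open import Data.Integer as ℤ using (ℤ; +_; -[1+_]; ∣_∣)
open import Data.List using (List; []; _∷_; map; filter; foldl; length; upTo; concatMap; foldr)
open import Data.List.Relation.Unary.All using (All)
open import Data.List.Relation.Unary.Unique.DecPropositional ℕP._≟_ using (unique?)
open import Data.List.Relation.Unary.Unique.Propositional using (Unique)
open import Data.Product using (Σ; _×_)
open import Relation.Binary.PropositionalEquality using (_≡_)
open import Relation.Nullary using (Dec)

-- Signed permutations in one-line notation: σ = [σ(1),…,σ(n)] as a list of integers.

lists : {A : Set} → ℕ → List A → List (List A)
lists zero    xs = [] ∷ []
lists (suc k) xs = concatMap (λ x → map (x ∷_) (lists k xs)) xs

letters : ℕ → List ℤ
letters n = map (λ i → -[1+ i ]) (upTo n) Data.List.++ map (λ i → + suc i) (upTo n)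

Bn : ℕ → List (List ℤ)
Bn n = filter (λ σ → unique? (map ∣_∣ σ)) (lists n (letters n))

-- Coxeter generators acting on the right: σ s_0 negates σ(1);
-- σ s_i (i ≥ 1) swaps the entries in positions i and i+1.

swapAt : ℕ → List ℤ → List ℤ
swapAt zero    (x ∷ y ∷ xs) = y ∷ x ∷ xs
swapAt (suc i) (x ∷ xs)     = x ∷ swapAt i xs
swapAt _       xs           = xs

applyGen : ℕ → List ℤ → List ℤ
applyGen zero    []       = []
applyGen zero    (x ∷ xs) = ℤ.- x ∷ xs
applyGen (suc i) xs       = swapAt i xs

idPerm : ℕ → List ℤ
idPerm n = map (λ i → + suc i) (upTo n)

wordProd : ℕ → List ℕ → List ℤ
wordProd n w = foldl (λ σ i → applyGen i σ) (idPerm n) w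

IsLength : ℕ → List ℤ → ℕ → Set
IsLength n σ k =
  (Σ (List ℕ) λ w → All (_< n) w × length w ≡ k × wordProd n w ≡ σ) ×
  ((w : List ℕ) → All (_< n) w → wordProd n w ≡ σ → k ≤ length w)

neg : List ℤ → ℕ
neg []             = 0
neg (+ _ ∷ xs)     = neg xs
neg (-[1+ _ ] ∷ xs) = suc (neg xs)

-- strict order -1 < -2 < ⋯ < -n < 1 < 2 < ⋯ < n
ltB : ℤ → ℤ → Bool
ltB -[1+ a ] -[1+ b ] = a ℕ.<ᵇ b
ltB -[1+ _ ] (+ _)    = true
ltB (+ _)    -[1+ _ ] = false
ltB (+ a)    (+ b)    = a ℕ.<ᵇ b

-- sum of the (1-indexed) descent positions i, with position of the head = p
majFrom : ℕ → List ℤ → ℕ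
majFrom p (x ∷ y ∷ xs) = (if ltB y x then p else 0) ℕ.+ majFrom (suc p) (y ∷ xs)
majFrom p _            = 0

maj : List ℤ → ℕ
maj σ = majFrom 1 σ

fmaj : List ℤ → ℕ
fmaj σ = 2 ℕ.* maj σ ℕ.+ neg σ

-- number of inversions of a word of naturals (sign = (-1)^inv)
inv : List ℕ → ℕ
inv []       = 0
inv (x ∷ xs) = length (filter (λ y → y ℕ.<? x) xs) ℕ.+ inv xs

isEven : ℕ → Bool
isEven zero          = true
isEven (suc zero)    = false
isEven (suc (suc n)) = isEven n

-- q-integers and products, evaluated at an integer q

sumℤ : List ℤ → ℤ
sumℤ = foldr ℤ._+_ (+ 0)

_^ᶻ_ : ℤ → ℕ → ℤ
q ^ᶻ zero  = + 1
q ^ᶻ suc k = q ℤ.* (q ^ᶻ k)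

qint : ℕ → ℤ → ℤ
qint k q = sumℤ (map (q ^ᶻ_) (upTo k))

altSign : ℕ → ℤ → ℤ
altSign i q = if isEven i then q else ℤ.- q

prodQ : ℕ → (ℕ → ℤ) → ℤ
prodQ zero    f = + 1
prodQ (suc n) f = prodQ n f ℤ.* qint (2 ℕ.* suc n) (f (suc n))

fmajSum : ℤ → (List ℤ → Bool) → List (List ℤ) → ℤ
fmajSum q P xs = sumℤ (map (λ σ → if P σ then q ^ᶻ fmaj σ else + 0) xs)

module Submission where

-- Every signed permutation of [n+1] arises uniquely by inserting n+1 or -(n+1) into one of [n].
-- Inserting a new letter into a word w in its |w| + 1 positions raises maj by 0, 1, …, |w|, one each,
-- so with fmaj = 2 maj + neg one gets ∑_{B_n} q^fmaj = [2]_q [4]_q ⋯ [2n]_q.  Inserting a letter of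
-- largest absolute value multiplies sign(|σ|) by (-1)^(number of letters after it); to control this
-- sign one inserts the two largest letters at once.  Of the four sign patterns, the two mixed ones
-- cancel against each other, and each same-sign pair a < b (with no letter of w in between) satisfies
-- (1 + x) ∑ ± x^maj = x^maj(w) [|w|+1]_x (1 - x^(|w|+2)) for x = q², giving the two-step recursion
-- ∑_{B_{n+2}} sign(|σ|) q^fmaj = [2n+2]_{±q} [2n+4]_{∓q} ∑_{B_n} sign(|σ|) q^fmaj.
-- Finally (-1)^ℓ(σ) = sign(|σ|) (-1)^neg(σ) and (-1)^neg(σ) q^fmaj(σ) = (-q)^fmaj(σ), so twice each of the
-- three sums is ∑ q^fmaj plus one of the twisted sums, evaluated at q or -q.

open import Defs
open import Data.Bool using (Bool; true; false; if_then_else_; not; T; _∧_; _∨_)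
open import Data.Nat as ℕ using (ℕ; zero; suc; _<_)
import Data.Nat.Properties as ℕP
open import Data.Integer as ℤ using (ℤ; +_; -[1+_]; _+_; _*_; -_; _-_; ∣_∣)
import Data.Integer.Properties as ℤP
open import Data.Integer.Tactic.RingSolver using (solve-∀)
open import Data.List using (List; []; _∷_; map; _++_; length; _∷ʳ_; concatMap; filter; upTo; applyUpTo; foldl)
import Data.List.Properties as LP
open import Data.List.Relation.Unary.All as All using (All; []; _∷_)
import Data.List.Relation.Unary.All.Properties as AllP
open import Data.List.Relation.Unary.AllPairs.Core using ([]; _∷_)
open import Data.List.Relation.Unary.Any using (here; there)
open import Data.List.Relation.Unary.Unique.DecPropositional ℕP._≟_ using (unique?)
open import Data.List.Relation.Unary.Unique.Propositional using (Unique)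
open import Data.List.Membership.Propositional using (_∈_)
open import Data.List.Reverse using (Reverse; []; _∶_∶ʳ_; reverseView)
open import Data.Product using (_×_; _,_; proj₁; proj₂)
open import Data.Sum as Sum using (_⊎_; inj₁; inj₂)
open import Data.Unit using (⊤; tt)
open import Data.Empty using (⊥; ⊥-elim)
open import Function using (_∘_)
open import Level using (0ℓ)
open import Algebra.Properties.CommutativeSemigroup ℕP.+-commutativeSemigroup using (x∙yz≈y∙xz)
open import Relation.Nullary using (¬_; yes; no; does)
open import Relation.Unary using (Pred; Decidable)
open import Relation.Binary.PropositionalEquality

-1^_ : ℕ → ℤ
-1^ n = if isEven n then + 1 else - + 1

isEven-suc : ∀ n → isEven (suc n) ≡ not (isEven n)
isEven-suc zero = refl
isEven-suc (suc zero) = refl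
isEven-suc (suc (suc n)) = isEven-suc n

-1^-suc : ∀ n → -1^ (suc n) ≡ - -1^ n
-1^-suc n rewrite isEven-suc n with isEven n
... | true = refl
... | false = refl

-1^-+ : ∀ m n → -1^ (m ℕ.+ n) ≡ -1^ m * -1^ n
-1^-+ zero n = sym (ℤP.*-identityˡ (-1^ n))
-1^-+ (suc m) n rewrite -1^-suc (m ℕ.+ n) | -1^-suc m | -1^-+ m n = ℤP.neg-distribˡ-* (-1^ m) (-1^ n)

-1^-square : ∀ n → -1^ n * -1^ n ≡ + 1
-1^-square n with isEven n
... | true = refl
... | false = refl

sumℤ-++ : ∀ xs ys → sumℤ (xs ++ ys) ≡ sumℤ xs + sumℤ ys
sumℤ-++ [] ys = sym (ℤP.+-identityˡ _)
sumℤ-++ (x ∷ xs) ys rewrite sumℤ-++ xs ys = sym (ℤP.+-assoc x _ _)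

∑ : {A : Set} → (A → ℤ) → List A → ℤ
∑ f xs = sumℤ (map f xs)

∑-++ : {A : Set} (f : A → ℤ) (xs ys : List A) → ∑ f (xs ++ ys) ≡ ∑ f xs + ∑ f ys
∑-++ f xs ys rewrite LP.map-++ f xs ys = sumℤ-++ (map f xs) (map f ys)

∑-cong : {A : Set} {f g : A → ℤ} → (∀ x → f x ≡ g x) → (xs : List A) → ∑ f xs ≡ ∑ g xs
∑-cong e [] = refl
∑-cong e (x ∷ xs) = cong₂ _+_ (e x) (∑-cong e xs)

∑-map : {A B : Set} (f : B → ℤ) (g : A → B) (xs : List A) → ∑ f (map g xs) ≡ ∑ (f ∘ g) xs
∑-map f g [] = refl
∑-map f g (x ∷ xs) = cong (λ z → f (g x) + z) (∑-map f g xs)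

∑-concatMap : {A B : Set} (f : B → ℤ) (g : A → List B) (xs : List A) → ∑ f (concatMap g xs) ≡ ∑ (λ x → ∑ f (g x)) xs
∑-concatMap f g [] = refl
∑-concatMap f g (x ∷ xs) = trans (∑-++ f (g x) (concatMap g xs)) (cong (λ z → ∑ f (g x) + z) (∑-concatMap f g xs))

∑-scale : {A : Set} (k : ℤ) (f : A → ℤ) (xs : List A) → ∑ (λ x → k * f x) xs ≡ k * ∑ f xs
∑-scale k f [] = sym (ℤP.*-zeroʳ k)
∑-scale k f (x ∷ xs) rewrite ∑-scale k f xs = sym (ℤP.*-distribˡ-+ k (f x) _)

∑-+ : {A : Set} (f g : A → ℤ) (xs : List A) → ∑ (λ x → f x + g x) xs ≡ ∑ f xs + ∑ g xs
∑-+ f g [] = refl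
∑-+ f g (x ∷ xs) rewrite ∑-+ f g xs = lem (f x) (g x) (∑ f xs) (∑ g xs)
  where lem : ∀ a b c d → a + b + (c + d) ≡ a + c + (b + d)
        lem = solve-∀

∑-zero : {A : Set} (xs : List A) → ∑ {A} (λ _ → + 0) xs ≡ + 0
∑-zero [] = refl
∑-zero (x ∷ xs) = trans (ℤP.+-identityˡ _) (∑-zero xs)

^ᶻ-+ : ∀ q m n → q ^ᶻ (m ℕ.+ n) ≡ q ^ᶻ m * q ^ᶻ n
^ᶻ-+ q zero n = sym (ℤP.*-identityˡ _)
^ᶻ-+ q (suc m) n rewrite ^ᶻ-+ q m n = sym (ℤP.*-assoc q _ _)

^ᶻ-double : ∀ q k → q ^ᶻ (2 ℕ.* k) ≡ (q * q) ^ᶻ k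
^ᶻ-double q zero = refl
^ᶻ-double q (suc k) rewrite ℕP.+-suc k (k ℕ.+ 0) | ^ᶻ-double q k = sym (ℤP.*-assoc q q _)

neg-^ᶻ : ∀ q k → (- q) ^ᶻ k ≡ -1^ k * q ^ᶻ k
neg-^ᶻ q zero = refl
neg-^ᶻ q (suc k) rewrite neg-^ᶻ q k | -1^-suc k = lem q (-1^ k) (q ^ᶻ k)
  where lem : ∀ a b c → - a * (b * c) ≡ - b * (a * c)
        lem = solve-∀

qint-suc : ∀ k q → qint (suc k) q ≡ qint k q + q ^ᶻ k
qint-suc k q = begin
    sumℤ (map (q ^ᶻ_) (upTo (suc k)))        ≡⟨ cong (λ l → sumℤ (map (q ^ᶻ_) l)) (sym (LP.upTo-∷ʳ k)) ⟩
    sumℤ (map (q ^ᶻ_) (upTo k ++ k ∷ []))    ≡⟨ ∑-++ (q ^ᶻ_) (upTo k) (k ∷ []) ⟩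
    qint k q + (q ^ᶻ k + + 0)                ≡⟨ cong (λ z → qint k q + z) (ℤP.+-identityʳ _) ⟩
    qint k q + q ^ᶻ k ∎
  where open ≡-Reasoning

qint-geometric : ∀ k q → (q - + 1) * qint k q ≡ q ^ᶻ k - + 1
qint-geometric zero q = ℤP.*-zeroʳ (q - + 1)
qint-geometric (suc k) q rewrite qint-suc k q = lem q (qint k q) (q ^ᶻ k) (qint-geometric k q)
  where lem : ∀ q Q X → (q - + 1) * Q ≡ X - + 1 → (q - + 1) * (Q + X) ≡ q * X - + 1
        lem q Q X e = begin
            (q - + 1) * (Q + X) ≡⟨ l1 q Q X ⟩
            (q - + 1) * Q + (q * X - X) ≡⟨ cong (_+ (q * X - X)) e ⟩
            X - + 1 + (q * X - X) ≡⟨ l2 q X ⟩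
            q * X - + 1 ∎
          where open ≡-Reasoning
                l1 : ∀ q Q X → (q - + 1) * (Q + X) ≡ (q - + 1) * Q + (q * X - X)
                l1 = solve-∀
                l2 : ∀ q X → X - + 1 + (q * X - X) ≡ q * X - + 1
                l2 = solve-∀

qint-double : ∀ k y → qint (2 ℕ.* k) y ≡ (+ 1 + y) * qint k (y * y)
qint-double zero y = sym (ℤP.*-zeroʳ (+ 1 + y))
qint-double (suc k) y =
  begin
    qint (2 ℕ.* suc k) y ≡⟨ cong (λ j → qint j y) (ℕP.*-suc 2 k) ⟩
    qint (suc (suc (2 ℕ.* k))) y ≡⟨ qint-suc (suc (2 ℕ.* k)) y ⟩
    qint (suc (2 ℕ.* k)) y + y ^ᶻ suc (2 ℕ.* k) ≡⟨ cong (_+ y ^ᶻ suc (2 ℕ.* k)) (qint-suc (2 ℕ.* k) y) ⟩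
    qint (2 ℕ.* k) y + y ^ᶻ (2 ℕ.* k) + y * y ^ᶻ (2 ℕ.* k) ≡⟨ cong₂ (λ a b → a + b + y * b) (qint-double k y) (^ᶻ-double y k) ⟩
    (+ 1 + y) * qint k (y * y) + (y * y) ^ᶻ k + y * (y * y) ^ᶻ k ≡⟨ l3 y (qint k (y * y)) ((y * y) ^ᶻ k) ⟩
    (+ 1 + y) * (qint k (y * y) + (y * y) ^ᶻ k) ≡⟨ cong ((+ 1 + y) *_) (sym (qint-suc k (y * y))) ⟩
    (+ 1 + y) * qint (suc k) (y * y) ∎
  where open ≡-Reasoning
        l3 : ∀ y Q Z → (+ 1 + y) * Q + Z + y * Z ≡ (+ 1 + y) * (Q + Z)
        l3 = solve-∀

by-relation : ∀ {L R} (c r₁ r₂ : ℤ) → L ≡ R + c * (r₁ - r₂) → r₁ ≡ r₂ → L ≡ R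
by-relation {R = R} c r₁ r₂ L≡ r₁≡r₂ = trans L≡ (trans (cong (λ t → R + c * (t - r₂)) r₁≡r₂) (lemma R c r₂))
  where lemma : ∀ R c r → R + c * (r - r) ≡ R
        lemma = solve-∀

false≢true : false ≡ true → ⊥
false≢true ()

T⇒≡true : ∀ {b} → T b → b ≡ true
T⇒≡true {true} _ = refl

<⇒<ᵇ≡true : ∀ {k n} → k ℕ.< n → (k ℕ.<ᵇ n) ≡ true
<⇒<ᵇ≡true p = T⇒≡true (ℕP.<⇒<ᵇ p)

<ᵇ-trans : ∀ a b c → (a ℕ.<ᵇ b) ≡ true → (b ℕ.<ᵇ c) ≡ true → (a ℕ.<ᵇ c) ≡ true
<ᵇ-trans zero (suc b) (suc c) p q = refl
<ᵇ-trans (suc a) (suc b) (suc c) p q = <ᵇ-trans a b c p q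
<ᵇ-trans zero zero c () q
<ᵇ-trans (suc a) zero c () q
<ᵇ-trans a (suc b) zero p ()

<ᵇ-asym : ∀ a b → (a ℕ.<ᵇ b) ≡ true → (b ℕ.<ᵇ a) ≡ false
<ᵇ-asym zero (suc b) p = refl
<ᵇ-asym (suc a) (suc b) p = <ᵇ-asym a b p
<ᵇ-asym zero zero ()
<ᵇ-asym (suc a) zero ()

<ᵇ-tri : ∀ a b → ¬ a ≡ b → (a ℕ.<ᵇ b) ≡ true ⊎ (b ℕ.<ᵇ a) ≡ true
<ᵇ-tri zero zero ne = ⊥-elim (ne refl)
<ᵇ-tri zero (suc b) ne = inj₁ refl
<ᵇ-tri (suc a) zero ne = inj₂ refl
<ᵇ-tri (suc a) (suc b) ne = <ᵇ-tri a b (λ e → ne (cong suc e))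

<ᵇ-irrefl : ∀ a → (a ℕ.<ᵇ a) ≡ false
<ᵇ-irrefl zero = refl
<ᵇ-irrefl (suc a) = <ᵇ-irrefl a

>⇒<ᵇ≡false : ∀ {k n} → k ℕ.< n → (n ℕ.<ᵇ k) ≡ false
>⇒<ᵇ≡false {k} {n} p = <ᵇ-asym k n (<⇒<ᵇ≡true p)

ltB-trans : ∀ x y z → ltB x y ≡ true → ltB y z ≡ true → ltB x z ≡ true
ltB-trans -[1+ a ] -[1+ b ] -[1+ c ] p q = <ᵇ-trans a b c p q
ltB-trans -[1+ a ] -[1+ b ] (+ c) p q = refl
ltB-trans -[1+ a ] (+ b) -[1+ c ] p ()
ltB-trans -[1+ a ] (+ b) (+ c) p q = refl
ltB-trans (+ a) -[1+ b ] z () q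
ltB-trans (+ a) (+ b) -[1+ c ] p ()
ltB-trans (+ a) (+ b) (+ c) p q = <ᵇ-trans a b c p q

ltB-asym : ∀ x y → ltB x y ≡ true → ltB y x ≡ false
ltB-asym -[1+ a ] -[1+ b ] p = <ᵇ-asym a b p
ltB-asym -[1+ a ] (+ b) p = refl
ltB-asym (+ a) -[1+ b ] ()
ltB-asym (+ a) (+ b) p = <ᵇ-asym a b p

ltB-tri : ∀ x y → ¬ x ≡ y → ltB x y ≡ true ⊎ ltB y x ≡ true
ltB-tri -[1+ a ] -[1+ b ] ne = <ᵇ-tri a b (λ e → ne (cong -[1+_] e))
ltB-tri -[1+ a ] (+ b) ne = inj₁ refl
ltB-tri (+ a) -[1+ b ] ne = inj₂ refl
ltB-tri (+ a) (+ b) ne = <ᵇ-tri a b (λ e → ne (cong +_ e))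

ltB-irrefl : ∀ x → ltB x x ≡ false
ltB-irrefl -[1+ a ] = <ᵇ-irrefl a
ltB-irrefl (+ a) = <ᵇ-irrefl a

ltB-not : ∀ c y → ¬ c ≡ y → ltB c y ≡ not (ltB y c)
ltB-not c y ne with ltB-tri c y ne
... | inj₁ p rewrite p | ltB-asym c y p = refl
... | inj₂ p rewrite p | ltB-asym y c p = refl

ltB-flip : ∀ a b → ¬ a ≡ b → ltB a b ≡ false → ltB b a ≡ true
ltB-flip a b a≢b a≮b with ltB-tri a b a≢b
... | inj₂ b<a = b<a
... | inj₁ a<b with trans (sym a≮b) a<b
...   | ()

ltB-false-trans : ∀ c z y → ¬ c ≡ z → ¬ c ≡ y → ltB c z ≡ false → ltB y c ≡ false → ltB y z ≡ false
ltB-false-trans c z y c≢z c≢y c≮z y≮c =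
  ltB-asym z y (ltB-trans z c y (ltB-flip c z c≢z c≮z) (ltB-flip y c (λ e → c≢y (sym e)) y≮c))

∷ʳ-∷ʳ : ∀ {A : Set} (w : List A) a b → (w ∷ʳ a) ∷ʳ b ≡ w ++ a ∷ b ∷ []
∷ʳ-∷ʳ w a b = LP.++-assoc w (a ∷ []) (b ∷ [])

∷ʳ-++ : ∀ {A : Set} (w : List A) a v → w ++ a ∷ v ≡ (w ∷ʳ a) ++ v
∷ʳ-++ w a v = sym (LP.++-assoc w (a ∷ []) v)

∷ʳ-∷ʳ-∷ʳ : ∀ {A : Set} (w : List A) a b c → ((w ∷ʳ a) ∷ʳ b) ∷ʳ c ≡ w ++ a ∷ b ∷ c ∷ []
∷ʳ-∷ʳ-∷ʳ w a b c = trans (∷ʳ-∷ʳ (w ∷ʳ a) b c) (sym (∷ʳ-++ w a (b ∷ c ∷ [])))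

∷ʳ-++-∷ʳ : ∀ {A : Set} (w : List A) a b c d → (w ++ a ∷ b ∷ c ∷ []) ∷ʳ d ≡ ((w ∷ʳ a) ∷ʳ b) ++ c ∷ d ∷ []
∷ʳ-++-∷ʳ w a b c d = trans (cong (_∷ʳ d) (sym (∷ʳ-∷ʳ-∷ʳ w a b c))) (∷ʳ-∷ʳ ((w ∷ʳ a) ∷ʳ b) c d)

length-∷ʳ : ∀ (w : List ℤ) y → length (w ++ y ∷ []) ≡ suc (length w)
length-∷ʳ [] y = refl
length-∷ʳ (x ∷ w) y = cong suc (length-∷ʳ w y)

ifElse0ᴺ : Bool → ℕ → ℕ
ifElse0ᴺ b k = if b then k else 0

ifElse1 : Bool → ℤ → ℤ
ifElse1 b v = if b then v else + 1

^ᶻ-ifElse0 : ∀ x b k → x ^ᶻ ifElse0ᴺ b k ≡ ifElse1 b (x ^ᶻ k)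
^ᶻ-ifElse0 x true k = refl
^ᶻ-ifElse0 x false k = refl

^ᶻ-+-ifElse0 : ∀ x a b k → x ^ᶻ (a ℕ.+ ifElse0ᴺ b k) ≡ x ^ᶻ a * ifElse1 b (x ^ᶻ k)
^ᶻ-+-ifElse0 x a b k = trans (^ᶻ-+ x a (ifElse0ᴺ b k)) (cong (x ^ᶻ a *_) (^ᶻ-ifElse0 x b k))

^ᶻ-+-ifElse0₂ : ∀ x a b k b′ k′ → x ^ᶻ (a ℕ.+ ifElse0ᴺ b k ℕ.+ ifElse0ᴺ b′ k′) ≡ x ^ᶻ a * ifElse1 b (x ^ᶻ k) * ifElse1 b′ (x ^ᶻ k′)
^ᶻ-+-ifElse0₂ x a b k b′ k′ = trans (^ᶻ-+-ifElse0 x (a ℕ.+ ifElse0ᴺ b k) b′ k′) (cong (_* ifElse1 b′ (x ^ᶻ k′)) (^ᶻ-+-ifElse0 x a b k))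

^ᶻ-+-ifElse0₃ : ∀ x a b k b′ k′ b″ k″ →
  x ^ᶻ (a ℕ.+ ifElse0ᴺ b k ℕ.+ ifElse0ᴺ b′ k′ ℕ.+ ifElse0ᴺ b″ k″) ≡ x ^ᶻ a * ifElse1 b (x ^ᶻ k) * ifElse1 b′ (x ^ᶻ k′) * ifElse1 b″ (x ^ᶻ k″)
^ᶻ-+-ifElse0₃ x a b k b′ k′ b″ k″ =
  trans (^ᶻ-+-ifElse0 x (a ℕ.+ ifElse0ᴺ b k ℕ.+ ifElse0ᴺ b′ k′) b″ k″) (cong (_* ifElse1 b″ (x ^ᶻ k″)) (^ᶻ-+-ifElse0₂ x a b k b′ k′))

majFrom-snoc : ∀ p v z y → majFrom p (v ++ z ∷ y ∷ []) ≡ majFrom p (v ++ z ∷ []) ℕ.+ ifElse0ᴺ (ltB y z) (p ℕ.+ length v)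
majFrom-snoc p [] z y = trans (cong (λ k → ifElse0ᴺ (ltB y z) k ℕ.+ 0) (sym (ℕP.+-identityʳ p))) (ℕP.+-identityʳ _)
majFrom-snoc p (a ∷ []) z y rewrite majFrom-snoc (suc p) [] z y
  | ℕP.+-suc p 0 = sym (ℕP.+-assoc (ifElse0ᴺ (ltB z a) p) 0 _)
majFrom-snoc p (a ∷ b ∷ v) z y rewrite majFrom-snoc (suc p) (b ∷ v) z y
  | ℕP.+-suc p (suc (length v)) = sym (ℕP.+-assoc (ifElse0ᴺ (ltB b a) p) (majFrom (suc p) (b ∷ v ++ z ∷ [])) _)

maj-∷ʳ : ∀ u z y → maj ((u ∷ʳ z) ∷ʳ y) ≡ maj (u ∷ʳ z) ℕ.+ ifElse0ᴺ (ltB y z) (suc (length u))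
maj-∷ʳ u z y = trans (cong maj (∷ʳ-∷ʳ u z y)) (majFrom-snoc 1 u z y)

^ᶻ-maj-∷ʳ : ∀ x u z y → x ^ᶻ maj ((u ∷ʳ z) ∷ʳ y) ≡ ifElse1 (ltB y z) (x ^ᶻ suc (length u)) * x ^ᶻ maj (u ∷ʳ z)
^ᶻ-maj-∷ʳ x u z y = trans (cong (x ^ᶻ_) (maj-∷ʳ u z y))
  (trans (^ᶻ-+-ifElse0 x (maj (u ∷ʳ z)) (ltB y z) (suc (length u))) (ℤP.*-comm (x ^ᶻ maj (u ∷ʳ z)) _))

-- ∑ins F c w sums F s u over the |w| + 1 words u obtained by inserting the letter c into w,
-- where s = (-1)^(number of letters after c in u).
∑ins : (ℤ → List ℤ → ℤ) → ℤ → List ℤ → ℤ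
∑ins F c [] = F (+ 1) (c ∷ [])
∑ins F c (y ∷ w) = F (-1^ (suc (length w))) (c ∷ y ∷ w) + ∑ins (λ s u → F s (y ∷ u)) c w

∑ins-cong : ∀ {F G : ℤ → List ℤ → ℤ} c w → (∀ s u → F s u ≡ G s u) → ∑ins F c w ≡ ∑ins G c w
∑ins-cong c [] e = e _ _
∑ins-cong c (y ∷ w) e = cong₂ _+_ (e _ _) (∑ins-cong c w (λ s u → e s (y ∷ u)))

∑ins-cong-length : ∀ {F G : ℤ → List ℤ → ℤ} c w → (∀ s u → length u ≡ suc (length w) → F s u ≡ G s u) → ∑ins F c w ≡ ∑ins G c w
∑ins-cong-length c [] e = e _ _ refl
∑ins-cong-length c (y ∷ w) e = cong₂ _+_ (e _ _ refl) (∑ins-cong-length c w (λ s u eq → e s (y ∷ u) (cong suc eq)))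

∑ins-cong-All : ∀ {F G : ℤ → List ℤ → ℤ} {P : ℤ → Set} c w → P c → All P w → (∀ s u → All P u → F s u ≡ G s u) → ∑ins F c w ≡ ∑ins G c w
∑ins-cong-All c [] pc pw e = e _ _ (pc ∷ [])
∑ins-cong-All c (y ∷ w) pc (py ∷ pw) e = cong₂ _+_ (e _ _ (pc ∷ py ∷ pw)) (∑ins-cong-All c w pc pw (λ s u pu → e s (y ∷ u) (py ∷ pu)))

∑ins-+ : ∀ (F G : ℤ → List ℤ → ℤ) c w → ∑ins (λ s u → F s u + G s u) c w ≡ ∑ins F c w + ∑ins G c w
∑ins-+ F G c [] = refl
∑ins-+ F G c (y ∷ w) rewrite ∑ins-+ (λ s u → F s (y ∷ u)) (λ s u → G s (y ∷ u)) c w =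
  lem (F _ _) (G _ _) (∑ins (λ s u → F s (y ∷ u)) c w) (∑ins (λ s u → G s (y ∷ u)) c w)
  where lem : ∀ a b c d → a + b + (c + d) ≡ a + c + (b + d)
        lem = solve-∀

∑ins-scale : ∀ (k : ℤ) (F : ℤ → List ℤ → ℤ) c w → ∑ins (λ s u → k * F s u) c w ≡ k * ∑ins F c w
∑ins-scale k F c [] = refl
∑ins-scale k F c (y ∷ w) rewrite ∑ins-scale k (λ s u → F s (y ∷ u)) c w = sym (ℤP.*-distribˡ-+ k _ _)

∑ins-neg : ∀ (F : ℤ → List ℤ → ℤ) c w → ∑ins (λ s u → - F s u) c w ≡ - ∑ins F c w
∑ins-neg F c [] = refl
∑ins-neg F c (y ∷ w) rewrite ∑ins-neg (λ s u → F s (y ∷ u)) c w = sym (ℤP.neg-distrib-+ (F (-1^ (suc (length w))) (c ∷ y ∷ w)) (∑ins (λ s u → F s (y ∷ u)) c w))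

∑ins-map : ∀ (F : ℤ → List ℤ → ℤ) (h : ℤ → ℤ) c w → ∑ins F (h c) (map h w) ≡ ∑ins (λ s u → F s (map h u)) c w
∑ins-map F h c [] = refl
∑ins-map F h c (y ∷ w) rewrite ∑ins-map (λ s u → F s (h y ∷ u)) h c w | LP.length-map h w = refl

∑ins-snoc : ∀ (F : ℤ → List ℤ → ℤ) c w y → ∑ins F c (w ++ y ∷ []) ≡ ∑ins (λ s u → F (- s) (u ++ y ∷ [])) c w + F (+ 1) (w ++ y ∷ c ∷ [])
∑ins-snoc F c [] y = refl
∑ins-snoc F c (z ∷ w) y rewrite ∑ins-snoc (λ s u → F s (z ∷ u)) c w y | length-∷ʳ w y | -1^-suc (suc (length w)) =
  sym (ℤP.+-assoc (F (- -1^ (suc (length w))) (c ∷ z ∷ w ++ y ∷ [])) _ _)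

∑insMaj-snoc-identity : ∀ (x M Q Y : ℤ) (A B e : Bool) → (x - + 1) * Q ≡ x * (x * Y) - + 1 →
  (A ≡ true → B ≡ true → e ≡ true) → (A ≡ false → B ≡ false → e ≡ false) →
  ifElse1 e (x * (x * Y)) * (M * Q - M * ifElse1 A (x * Y)) + M * ifElse1 A (x * Y) * ifElse1 B (x * (x * Y))
    + M * ifElse1 e (x * Y) * ifElse1 (not B) (x * (x * Y))
  ≡ M * ifElse1 e (x * Y) * (Q + x * (x * Y))
∑insMaj-snoc-identity x M Q Y true true true rel _ _ = by-relation (M * (x * Y)) _ _ (lemma x M Q Y) rel
  where lemma : ∀ x M Q Y → x * (x * Y) * (M * Q - M * (x * Y)) + M * (x * Y) * (x * (x * Y)) + M * (x * Y) * + 1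
                  ≡ M * (x * Y) * (Q + x * (x * Y)) + M * (x * Y) * ((x - + 1) * Q - (x * (x * Y) - + 1))
        lemma = solve-∀
∑insMaj-snoc-identity x M Q Y true false true rel _ _ = by-relation (M * (x * Y)) _ _ (lemma x M Q Y) rel
  where lemma : ∀ x M Q Y → x * (x * Y) * (M * Q - M * (x * Y)) + M * (x * Y) * + 1 + M * (x * Y) * (x * (x * Y))
                  ≡ M * (x * Y) * (Q + x * (x * Y)) + M * (x * Y) * ((x - + 1) * Q - (x * (x * Y) - + 1))
        lemma = solve-∀
∑insMaj-snoc-identity x M Q Y false true true rel _ _ = by-relation (M * (x * Y)) _ _ (lemma x M Q Y) rel
  where lemma : ∀ x M Q Y → x * (x * Y) * (M * Q - M * + 1) + M * + 1 * (x * (x * Y)) + M * (x * Y) * + 1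
                  ≡ M * (x * Y) * (Q + x * (x * Y)) + M * (x * Y) * ((x - + 1) * Q - (x * (x * Y) - + 1))
        lemma = solve-∀
∑insMaj-snoc-identity x M Q Y true false false _ _ _ = lemma x M Q Y
  where lemma : ∀ x M Q Y → + 1 * (M * Q - M * (x * Y)) + M * (x * Y) * + 1 + M * + 1 * (x * (x * Y))
                  ≡ M * + 1 * (Q + x * (x * Y))
        lemma = solve-∀
∑insMaj-snoc-identity x M Q Y false true false _ _ _ = lemma x M Q Y
  where lemma : ∀ x M Q Y → + 1 * (M * Q - M * + 1) + M * + 1 * (x * (x * Y)) + M * + 1 * + 1
                  ≡ M * + 1 * (Q + x * (x * Y))
        lemma = solve-∀
∑insMaj-snoc-identity x M Q Y false false false _ _ _ = lemma x M Q Y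
  where lemma : ∀ x M Q Y → + 1 * (M * Q - M * + 1) + M * + 1 * + 1 + M * + 1 * (x * (x * Y))
                  ≡ M * + 1 * (Q + x * (x * Y))
        lemma = solve-∀
∑insMaj-snoc-identity x M Q Y true true false _ tt⇒t _ with tt⇒t refl refl
... | ()
∑insMaj-snoc-identity x M Q Y false false true _ _ ff⇒f with ff⇒f refl refl
... | ()

∑insMaj : ℤ → ℤ → List ℤ → ℤ
∑insMaj x c w = ∑ins (λ _ u → x ^ᶻ maj u) c w

module ∑insMaj-snoc (x c : ℤ) (u : List ℤ) (z y : ℤ) (c∉ : All (λ t → ¬ c ≡ t) ((u ∷ʳ z) ∷ʳ y)) where
  private
    w = u ∷ʳ z
    m = length u
    M = x ^ᶻ maj w
    Q = qint (suc (suc m)) x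
    A = ltB c z
    B = ltB y c
    e = ltB y z
    S = ∑ins (λ _ v → x ^ᶻ maj (v ∷ʳ z)) c u

    c≢y : ¬ c ≡ y
    c≢y = All.head (AllP.++⁻ʳ w c∉)

    c≢z : ¬ c ≡ z
    c≢z = All.head (AllP.++⁻ʳ u (AllP.++⁻ˡ w c∉))

    length-w : length w ≡ suc m
    length-w = length-∷ʳ u z

    c-last : x ^ᶻ maj (u ++ z ∷ c ∷ []) ≡ M * ifElse1 A (x ^ᶻ suc m)
    c-last = trans (cong (x ^ᶻ_) (majFrom-snoc 1 u z c)) (^ᶻ-+-ifElse0 x (maj w) A (suc m))

    c-before-y : x ^ᶻ maj ((u ++ z ∷ c ∷ []) ∷ʳ y) ≡ M * ifElse1 A (x ^ᶻ suc m) * ifElse1 B (x ^ᶻ suc (suc m))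
    c-before-y = begin
      x ^ᶻ maj ((u ++ z ∷ c ∷ []) ∷ʳ y)   ≡⟨ cong (λ v → x ^ᶻ maj (v ∷ʳ y)) (sym (∷ʳ-∷ʳ u z c)) ⟩
      x ^ᶻ maj ((w ∷ʳ c) ∷ʳ y)             ≡⟨ cong (x ^ᶻ_) (maj-∷ʳ w c y) ⟩
      x ^ᶻ (maj (w ∷ʳ c) ℕ.+ ifElse0ᴺ B (suc (length w)))
        ≡⟨ cong (λ k → x ^ᶻ (maj (w ∷ʳ c) ℕ.+ ifElse0ᴺ B (suc k))) length-w ⟩
      x ^ᶻ (maj (w ∷ʳ c) ℕ.+ ifElse0ᴺ B (suc (suc m))) ≡⟨ ^ᶻ-+-ifElse0 x (maj (w ∷ʳ c)) B (suc (suc m)) ⟩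
      x ^ᶻ maj (w ∷ʳ c) * ifElse1 B (x ^ᶻ suc (suc m))
        ≡⟨ cong (λ t → t * ifElse1 B (x ^ᶻ suc (suc m))) (trans (cong (λ v → x ^ᶻ maj v) (∷ʳ-∷ʳ u z c)) c-last) ⟩
      M * ifElse1 A (x ^ᶻ suc m) * ifElse1 B (x ^ᶻ suc (suc m)) ∎
      where open ≡-Reasoning

    y-last : x ^ᶻ maj (w ∷ʳ y) ≡ M * ifElse1 e (x ^ᶻ suc m)
    y-last = trans (cong (x ^ᶻ_) (maj-∷ʳ u z y)) (^ᶻ-+-ifElse0 x (maj w) e (suc m))

    y-before-c : x ^ᶻ maj (w ++ y ∷ c ∷ []) ≡ M * ifElse1 e (x ^ᶻ suc m) * ifElse1 (not B) (x ^ᶻ suc (suc m))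
    y-before-c = begin
      x ^ᶻ maj (w ++ y ∷ c ∷ [])           ≡⟨ cong (x ^ᶻ_) (majFrom-snoc 1 w y c) ⟩
      x ^ᶻ (maj (w ∷ʳ y) ℕ.+ ifElse0ᴺ (ltB c y) (suc (length w)))
        ≡⟨ cong₂ (λ b k → x ^ᶻ (maj (w ∷ʳ y) ℕ.+ ifElse0ᴺ b (suc k))) (ltB-not c y c≢y) length-w ⟩
      x ^ᶻ (maj (w ∷ʳ y) ℕ.+ ifElse0ᴺ (not B) (suc (suc m))) ≡⟨ ^ᶻ-+-ifElse0 x (maj (w ∷ʳ y)) (not B) (suc (suc m)) ⟩
      x ^ᶻ maj (w ∷ʳ y) * ifElse1 (not B) (x ^ᶻ suc (suc m)) ≡⟨ cong (_* ifElse1 (not B) (x ^ᶻ suc (suc m))) y-last ⟩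
      M * ifElse1 e (x ^ᶻ suc m) * ifElse1 (not B) (x ^ᶻ suc (suc m)) ∎
      where open ≡-Reasoning

    c-inside-u : ∑ins (λ _ v → x ^ᶻ maj ((v ∷ʳ z) ∷ʳ y)) c u ≡ ifElse1 e (x ^ᶻ suc (suc m)) * S
    c-inside-u = trans (∑ins-cong-length c u append-y) (∑ins-scale (ifElse1 e (x ^ᶻ suc (suc m))) (λ _ v → x ^ᶻ maj (v ∷ʳ z)) c u)
      where
      append-y : ∀ s v → length v ≡ suc m → x ^ᶻ maj ((v ∷ʳ z) ∷ʳ y) ≡ ifElse1 e (x ^ᶻ suc (suc m)) * x ^ᶻ maj (v ∷ʳ z)
      append-y _ v length-v = trans (^ᶻ-maj-∷ʳ x v z y) (cong (λ k → ifElse1 e (x ^ᶻ suc k) * x ^ᶻ maj (v ∷ʳ z)) length-v)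

    S≡ : ∑insMaj x c w ≡ M * qint (suc (length w)) x → S ≡ M * Q - M * ifElse1 A (x ^ᶻ suc m)
    S≡ IH = trans (lemma S (M * ifElse1 A (x ^ᶻ suc m))) (cong (_- M * ifElse1 A (x ^ᶻ suc m)) S+last≡)
      where
      lemma : ∀ a b → a ≡ a + b - b
      lemma = solve-∀
      S+last≡ : S + M * ifElse1 A (x ^ᶻ suc m) ≡ M * Q
      S+last≡ = trans (cong (λ t → S + t) (sym c-last))
        (trans (sym (∑ins-snoc (λ _ v → x ^ᶻ maj v) c u z)) (trans IH (cong (λ k → M * qint (suc k) x) length-w)))

  closed : ∑insMaj x c w ≡ x ^ᶻ maj w * qint (suc (length w)) x →
           ∑insMaj x c (w ∷ʳ y) ≡ x ^ᶻ maj (w ∷ʳ y) * qint (suc (length (w ∷ʳ y))) x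
  closed IH = begin
    ∑insMaj x c (w ∷ʳ y)
      ≡⟨ ∑ins-snoc (λ _ v → x ^ᶻ maj v) c w y ⟩
    ∑ins (λ _ v → x ^ᶻ maj (v ∷ʳ y)) c w + x ^ᶻ maj (w ++ y ∷ c ∷ [])
      ≡⟨ cong (_+ x ^ᶻ maj (w ++ y ∷ c ∷ [])) (∑ins-snoc (λ _ v → x ^ᶻ maj (v ∷ʳ y)) c u z) ⟩
    ∑ins (λ _ v → x ^ᶻ maj ((v ∷ʳ z) ∷ʳ y)) c u + x ^ᶻ maj ((u ++ z ∷ c ∷ []) ∷ʳ y) + x ^ᶻ maj (w ++ y ∷ c ∷ [])
      ≡⟨ cong₂ _+_ (cong₂ _+_ (trans c-inside-u (cong (ifElse1 e (x ^ᶻ suc (suc m)) *_) (S≡ IH))) c-before-y) y-before-c ⟩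
    ifElse1 e (x * (x * x ^ᶻ m)) * (M * Q - M * ifElse1 A (x * x ^ᶻ m)) + M * ifElse1 A (x * x ^ᶻ m) * ifElse1 B (x * (x * x ^ᶻ m))
      + M * ifElse1 e (x * x ^ᶻ m) * ifElse1 (not B) (x * (x * x ^ᶻ m))
      ≡⟨ ∑insMaj-snoc-identity x M Q (x ^ᶻ m) A B e (qint-geometric (suc (suc m)) x)
           (λ c<z y<c → ltB-trans y c z y<c c<z) (ltB-false-trans c z y c≢z c≢y) ⟩
    M * ifElse1 e (x ^ᶻ suc m) * (Q + x ^ᶻ suc (suc m))
      ≡⟨ sym (cong₂ _*_ y-last (trans (cong (λ k → qint (suc k) x) (trans (length-∷ʳ w y) (cong suc length-w))) (qint-suc (suc (suc m)) x))) ⟩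
    x ^ᶻ maj (w ∷ʳ y) * qint (suc (length (w ∷ʳ y))) x ∎
    where open ≡-Reasoning

∑insMaj-closed : ∀ x c w → All (λ z → ¬ c ≡ z) w → ∑insMaj x c w ≡ x ^ᶻ maj w * qint (suc (length w)) x
∑insMaj-closed x c w nc = go (reverseView w) nc
  where
  go : ∀ {w} → Reverse w → All (λ z → ¬ c ≡ z) w → ∑insMaj x c w ≡ x ^ᶻ maj w * qint (suc (length w)) x
  go [] _ = refl
  go (.[] ∶ [] ∶ʳ y) (ny ∷ []) with ltB-tri c y ny
  ... | inj₁ p rewrite p | ltB-asym c y p = l x
    where l : ∀ x → + 1 + x * + 1 ≡ + 1 * (+ 1 + (x * + 1 + + 0))
          l = solve-∀
  ... | inj₂ p rewrite p | ltB-asym y c p = l x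
    where l : ∀ x → x * + 1 + + 1 ≡ + 1 * (+ 1 + (x * + 1 + + 0))
          l = solve-∀
  go (.(w1 ∷ʳ z) ∶ r0@(w1 ∶ r1 ∶ʳ z) ∶ʳ y) nc = ∑insMaj-snoc.closed x c w1 z y nc (go r0 (AllP.++⁻ˡ (w1 ∷ʳ z) nc))

∑ins² : (List ℤ → ℤ) → ℤ → ℤ → List ℤ → ℤ
∑ins² G a b w = ∑ins (λ s1 τ → ∑ins (λ s2 σ → s1 * s2 * G σ) b τ) a w

∑ins²-snoc : ∀ G a b w y → ∑ins² G a b (w ∷ʳ y) ≡
  ∑ins² (λ σ → G (σ ∷ʳ y)) a b w - ∑ins (λ s τ → s * G (τ ++ y ∷ b ∷ [])) a w + ∑ins (λ s σ → s * G (σ ++ y ∷ a ∷ [])) b w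
   - G (w ++ y ∷ b ∷ a ∷ []) + G (w ++ y ∷ a ∷ b ∷ [])
∑ins²-snoc G a b w y = begin
    ∑ins² G a b (w ∷ʳ y) ≡⟨ ∑ins-snoc H a w y ⟩
    ∑ins (λ s1 τ' → H (- s1) (τ' ∷ʳ y)) a w + H (+ 1) (w ++ y ∷ a ∷ []) ≡⟨ cong₂ _+_ part1 part2 ⟩
    (∑ins² G' a b w - Sa) + (Sb - Gba + Gab) ≡⟨ l (∑ins² G' a b w) Sa Sb Gba Gab ⟩
    ∑ins² G' a b w - Sa + Sb - Gba + Gab ∎
  where
  open ≡-Reasoning
  H : ℤ → List ℤ → ℤ
  H s1 τ = ∑ins (λ s2 σ → s1 * s2 * G σ) b τ
  G' = λ σ → G (σ ∷ʳ y)
  Sa = ∑ins (λ s τ → s * G (τ ++ y ∷ b ∷ [])) a w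
  Sb = ∑ins (λ s σ → s * G (σ ++ y ∷ a ∷ [])) b w
  Gba = G (w ++ y ∷ b ∷ a ∷ [])
  Gab = G (w ++ y ∷ a ∷ b ∷ [])
  l : ∀ d sa sb p q → (d - sa) + (sb - p + q) ≡ d - sa + sb - p + q
  l = solve-∀
  l2 : ∀ s1 s2 g → - s1 * - s2 * g ≡ s1 * s2 * g
  l2 = solve-∀
  l3 : ∀ s1 g → - s1 * + 1 * g ≡ - (s1 * g)
  l3 = solve-∀
  pt1 : ∀ s1 τ' → H (- s1) (τ' ∷ʳ y) ≡ ∑ins (λ s2 σ → s1 * s2 * G' σ) b τ' + - (s1 * G (τ' ++ y ∷ b ∷ []))
  pt1 s1 τ' = trans (∑ins-snoc (λ s2 σ → - s1 * s2 * G σ) b τ' y)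
                (cong₂ _+_ (∑ins-cong b τ' (λ s2 σ → l2 s1 s2 (G (σ ∷ʳ y)))) (l3 s1 _))
  part1 : ∑ins (λ s1 τ' → H (- s1) (τ' ∷ʳ y)) a w ≡ ∑ins² G' a b w - Sa
  part1 = trans (∑ins-cong a w pt1) (trans (∑ins-+ _ _ a w) (cong (λ t → ∑ins² G' a b w + t) (∑ins-neg (λ s τ → s * G (τ ++ y ∷ b ∷ [])) a w)))
  l4 : ∀ s g → + 1 * - - s * g ≡ s * g
  l4 = solve-∀
  l5 : ∀ S p q → S + + 1 * -[1+ 0 ] * p + + 1 * + 1 * q ≡ S - p + q
  l5 = solve-∀
  part2 : H (+ 1) (w ++ y ∷ a ∷ []) ≡ Sb - Gba + Gab
  part2 = begin
    H (+ 1) (w ++ y ∷ a ∷ []) ≡⟨ cong (H (+ 1)) (sym (∷ʳ-∷ʳ w y a)) ⟩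
    H (+ 1) ((w ∷ʳ y) ∷ʳ a) ≡⟨ ∑ins-snoc (λ s2 σ → + 1 * s2 * G σ) b (w ∷ʳ y) a ⟩
    ∑ins (λ s σ' → + 1 * (- s) * G (σ' ∷ʳ a)) b (w ∷ʳ y) + + 1 * + 1 * G ((w ∷ʳ y) ++ a ∷ b ∷ [])
      ≡⟨ cong (_+ (+ 1 * + 1 * G ((w ∷ʳ y) ++ a ∷ b ∷ []))) (∑ins-snoc (λ s σ' → + 1 * (- s) * G (σ' ∷ʳ a)) b w y) ⟩
    ∑ins (λ s σ'' → + 1 * (- - s) * G ((σ'' ∷ʳ y) ∷ʳ a)) b w + + 1 * -[1+ 0 ] * G ((w ++ y ∷ b ∷ []) ∷ʳ a) + + 1 * + 1 * G ((w ∷ʳ y) ++ a ∷ b ∷ [])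
      ≡⟨ cong₂ _+_ (cong₂ _+_ (∑ins-cong b w (λ s σ'' → trans (l4 s _) (cong (λ t → s * G t) (∷ʳ-∷ʳ σ'' y a))))
                                (cong (λ t → + 1 * -[1+ 0 ] * G t) (LP.++-assoc w (y ∷ b ∷ []) (a ∷ []))))
                    (cong (λ t → + 1 * + 1 * G t) (LP.++-assoc w (y ∷ []) (a ∷ b ∷ []))) ⟩
    Sb + + 1 * -[1+ 0 ] * Gba + + 1 * + 1 * Gab ≡⟨ l5 Sb Gba Gab ⟩
    Sb - Gba + Gab ∎

relabel : ℤ → ℤ → ℤ → ℤ → ℤ → ℤ
relabel a a' b b' z with z ℤP.≟ a
... | yes _ = a'
... | no _ with z ℤP.≟ b
...   | yes _ = b'
...   | no _ = z

relabel-a : ∀ a a' b b' → relabel a a' b b' a ≡ a'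
relabel-a a a' b b' with a ℤP.≟ a
... | yes _ = refl
... | no ne = ⊥-elim (ne refl)

relabel-b : ∀ a a' b b' → ¬ b ≡ a → relabel a a' b b' b ≡ b'
relabel-b a a' b b' ne with b ℤP.≟ a
... | yes e = ⊥-elim (ne e)
... | no _ with b ℤP.≟ b
...   | yes _ = refl
...   | no ne' = ⊥-elim (ne' refl)

relabel-other : ∀ a a' b b' z → ¬ z ≡ a → ¬ z ≡ b → relabel a a' b b' z ≡ z
relabel-other a a' b b' z na nb with z ℤP.≟ a
... | yes e = ⊥-elim (na e)
... | no _ with z ℤP.≟ b
...   | yes e = ⊥-elim (nb e)
...   | no _ = refl

map-relabel-id : ∀ a a' b b' w → All (λ z → ¬ z ≡ a × ¬ z ≡ b) w → map (relabel a a' b b') w ≡ w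
map-relabel-id a a' b b' [] [] = refl
map-relabel-id a a' b b' (z ∷ w) ((na , nb) ∷ pw) = cong₂ _∷_ (relabel-other a a' b b' z na nb) (map-relabel-id a a' b b' w pw)

KeepsOrder : (ℤ → ℤ) → ℤ → ℤ → Set
KeepsOrder h u v = ltB (h v) (h u) ≡ ltB v u

KeepsDescents : (ℤ → ℤ) → List ℤ → Set
KeepsDescents h (u ∷ v ∷ r) = KeepsOrder h u v × KeepsDescents h (v ∷ r)
KeepsDescents h _ = ⊤

majFrom-map : ∀ h p σ → KeepsDescents h σ → majFrom p (map h σ) ≡ majFrom p σ
majFrom-map h p [] _ = refl
majFrom-map h p (u ∷ []) _ = refl
majFrom-map h p (u ∷ v ∷ r) (ok , rest) = cong₂ ℕ._+_ (cong (λ b → if b then p else 0) ok) (majFrom-map h (suc p) (v ∷ r) rest)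

keepsDescents : ∀ {h} {P : ℤ → Set} → (∀ u v → P u → P v → KeepsOrder h u v) → ∀ σ → All P σ → KeepsDescents h σ
keepsDescents ok [] _ = tt
keepsDescents ok (u ∷ []) _ = tt
keepsDescents ok (u ∷ v ∷ r) (pu ∷ pv ∷ pr) = ok u v pu pv , keepsDescents ok (v ∷ r) (pv ∷ pr)

∑ins²-map : ∀ G h a b w → ∑ins² G (h a) (h b) (map h w) ≡ ∑ins² (λ σ → G (map h σ)) a b w
∑ins²-map G h a b w = trans (∑ins-map (λ s1 τ → ∑ins (λ s2 σ → s1 * s2 * G σ) (h b) τ) h a w)
                         (∑ins-cong a w (λ s1 τ → ∑ins-map (λ s2 σ → s1 * s2 * G σ) h b τ))

∑ins²-cons : ∀ G a b y w → ∑ins² G a b (y ∷ w) ≡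
  -1^ (suc (length w)) * -1^ (suc (suc (length w))) * G (b ∷ a ∷ y ∷ w) + -1^ (suc (length w)) * -1^ (suc (length w)) * G (a ∷ b ∷ y ∷ w)
  + -1^ (suc (length w)) * ∑ins (λ s σ → s * G (a ∷ y ∷ σ)) b w + -1^ (suc (suc (length w))) * ∑ins (λ s τ → s * G (b ∷ y ∷ τ)) a w
  + ∑ins² (λ σ → G (y ∷ σ)) a b w
∑ins²-cons G a b y w = trans (cong₂ _+_ e1 e2) (l P1P2G P1P1G (P1 * X1) (P2 * X2) (∑ins² (λ σ → G (y ∷ σ)) a b w))
  where
  P1 = -1^ (suc (length w))
  P2 = -1^ (suc (suc (length w)))
  P1P2G = P1 * P2 * G (b ∷ a ∷ y ∷ w)
  P1P1G = P1 * P1 * G (a ∷ b ∷ y ∷ w)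
  X1 = ∑ins (λ s σ → s * G (a ∷ y ∷ σ)) b w
  X2 = ∑ins (λ s τ → s * G (b ∷ y ∷ τ)) a w
  l : ∀ p q r t d → p + (q + r) + (t + d) ≡ p + q + r + t + d
  l = solve-∀
  as : ∀ a b c → a * b * c ≡ a * (b * c)
  as = solve-∀
  cm : ∀ a b c → a * b * c ≡ b * (a * c)
  cm = solve-∀
  e1 : ∑ins (λ s2 σ → P1 * s2 * G σ) b (a ∷ y ∷ w) ≡ P1P2G + (P1P1G + P1 * X1)
  e1 = cong (λ t → P1P2G + (P1P1G + t))
         (trans (∑ins-cong b w (λ s σ → as P1 s (G (a ∷ y ∷ σ)))) (∑ins-scale P1 (λ s σ → s * G (a ∷ y ∷ σ)) b w))
  e2 : ∑ins (λ s1 τ → ∑ins (λ s2 σ → s1 * s2 * G σ) b (y ∷ τ)) a w ≡ P2 * X2 + ∑ins² (λ σ → G (y ∷ σ)) a b w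
  e2 = trans (∑ins-+ (λ s1 τ → s1 * -1^ (suc (length τ)) * G (b ∷ y ∷ τ)) (λ s1 τ → ∑ins (λ s2 σ → s1 * s2 * G (y ∷ σ)) b τ) a w)
         (cong (_+ ∑ins² (λ σ → G (y ∷ σ)) a b w)
           (trans (∑ins-cong-length a w (λ s τ lτ → trans (cong (λ k → s * -1^ (suc k) * G (b ∷ y ∷ τ)) lτ) (cm s P2 (G (b ∷ y ∷ τ)))))
                  (∑ins-scale P2 (λ s τ → s * G (b ∷ y ∷ τ)) a w)))

∑ins²-swap : ∀ G a b w → ∑ins² G a b w ≡ - ∑ins² G b a w
∑ins²-swap G a b [] = l (G (b ∷ a ∷ [])) (G (a ∷ b ∷ []))
  where l : ∀ p q → + 1 * -[1+ 0 ] * p + + 1 * + 1 * q ≡ - (+ 1 * -[1+ 0 ] * q + + 1 * + 1 * p)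
        l = solve-∀
∑ins²-swap G a b (y ∷ w) = begin
    ∑ins² G a b (y ∷ w) ≡⟨ ∑ins²-cons G a b y w ⟩
    P1 * P2 * Gb + P1 * P1 * Ga + P1 * X1 + P2 * X2 + ∑ins² G' a b w
      ≡⟨ cong₂ (λ p d → P1 * p * Gb + P1 * P1 * Ga + P1 * X1 + p * X2 + d) (-1^-suc (suc (length w))) (∑ins²-swap G' a b w) ⟩
    P1 * - P1 * Gb + P1 * P1 * Ga + P1 * X1 + - P1 * X2 + - ∑ins² G' b a w ≡⟨ l P1 Gb Ga X1 X2 (∑ins² G' b a w) ⟩
    - (P1 * - P1 * Ga + P1 * P1 * Gb + P1 * X2 + - P1 * X1 + ∑ins² G' b a w)
      ≡⟨ cong (λ p → - (P1 * p * Ga + P1 * P1 * Gb + P1 * X2 + p * X1 + ∑ins² G' b a w)) (sym (-1^-suc (suc (length w)))) ⟩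
    - (P1 * P2 * Ga + P1 * P1 * Gb + P1 * X2 + P2 * X1 + ∑ins² G' b a w) ≡⟨ cong -_ (sym (∑ins²-cons G b a y w)) ⟩
    - ∑ins² G b a (y ∷ w) ∎
  where
  open ≡-Reasoning
  P1 = -1^ (suc (length w))
  P2 = -1^ (suc (suc (length w)))
  Gb = G (b ∷ a ∷ y ∷ w)
  Ga = G (a ∷ b ∷ y ∷ w)
  X1 = ∑ins (λ s σ → s * G (a ∷ y ∷ σ)) b w
  X2 = ∑ins (λ s τ → s * G (b ∷ y ∷ τ)) a w
  G' = λ σ → G (y ∷ σ)
  l : ∀ P Gb Ga X1 X2 D → P * - P * Gb + P * P * Ga + P * X1 + - P * X2 + - D ≡ - (P * - P * Ga + P * P * Gb + P * X2 + - P * X1 + D)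
  l = solve-∀

adjacent-step-identity-cases : ∀ (x M Q X : ℤ) (α β e : Bool) → (x - + 1) * Q ≡ x * X - + 1 →
  (α ≡ true → β ≡ false → e ≡ true) → (α ≡ false → β ≡ true → e ≡ false) →
  ifElse1 e (x * (x * X)) * (M * Q * (+ 1 - x * (x * X)))
    + (+ 1 + x) * (ifElse1 e (x * (x * X)) * (M * ifElse1 α X * (x * X - + 1))
                   + M * ifElse1 α X * ifElse1 (not β) (x * (x * X)) * (+ 1 - x * X)
                   + M * ifElse1 e X * ifElse1 β (x * X) * (+ 1 - x * (x * X)))
  ≡ M * ifElse1 e X * (Q + x * X) * (+ 1 - x * (x * (x * X)))
adjacent-step-identity-cases x M Q X true true true rel _ _ = by-relation (M * X * (+ 1 + x - x * (x * (x * X)))) _ _ (lemma x M Q X) rel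
  where lemma : ∀ x M Q X →
          x * (x * X) * (M * Q * (+ 1 - x * (x * X)))
            + (+ 1 + x) * (x * (x * X) * (M * X * (x * X - + 1)) + M * X * + 1 * (+ 1 - x * X) + M * X * (x * X) * (+ 1 - x * (x * X)))
          ≡ M * X * (Q + x * X) * (+ 1 - x * (x * (x * X))) + M * X * (+ 1 + x - x * (x * (x * X))) * ((x - + 1) * Q - (x * X - + 1))
        lemma = solve-∀
adjacent-step-identity-cases x M Q X true true false rel _ _ = by-relation (x * (x * (M * X))) _ _ (lemma x M Q X) rel
  where lemma : ∀ x M Q X →
          + 1 * (M * Q * (+ 1 - x * (x * X)))
            + (+ 1 + x) * (+ 1 * (M * X * (x * X - + 1)) + M * X * + 1 * (+ 1 - x * X) + M * + 1 * (x * X) * (+ 1 - x * (x * X)))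
          ≡ M * + 1 * (Q + x * X) * (+ 1 - x * (x * (x * X))) + x * (x * (M * X)) * ((x - + 1) * Q - (x * X - + 1))
        lemma = solve-∀
adjacent-step-identity-cases x M Q X true false true rel _ _ = by-relation (M * X * (+ 1 + x - x * (x * (x * X)))) _ _ (lemma x M Q X) rel
  where lemma : ∀ x M Q X →
          x * (x * X) * (M * Q * (+ 1 - x * (x * X)))
            + (+ 1 + x) * (x * (x * X) * (M * X * (x * X - + 1)) + M * X * (x * (x * X)) * (+ 1 - x * X) + M * X * + 1 * (+ 1 - x * (x * X)))
          ≡ M * X * (Q + x * X) * (+ 1 - x * (x * (x * X))) + M * X * (+ 1 + x - x * (x * (x * X))) * ((x - + 1) * Q - (x * X - + 1))
        lemma = solve-∀
adjacent-step-identity-cases x M Q X false true false rel _ _ = by-relation (x * (x * (M * X))) _ _ (lemma x M Q X) rel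
  where lemma : ∀ x M Q X →
          + 1 * (M * Q * (+ 1 - x * (x * X)))
            + (+ 1 + x) * (+ 1 * (M * + 1 * (x * X - + 1)) + M * + 1 * + 1 * (+ 1 - x * X) + M * + 1 * (x * X) * (+ 1 - x * (x * X)))
          ≡ M * + 1 * (Q + x * X) * (+ 1 - x * (x * (x * X))) + x * (x * (M * X)) * ((x - + 1) * Q - (x * X - + 1))
        lemma = solve-∀
adjacent-step-identity-cases x M Q X false false true rel _ _ = by-relation (M * X * (+ 1 + x - x * (x * (x * X)))) _ _ (lemma x M Q X) rel
  where lemma : ∀ x M Q X →
          x * (x * X) * (M * Q * (+ 1 - x * (x * X)))
            + (+ 1 + x) * (x * (x * X) * (M * + 1 * (x * X - + 1)) + M * + 1 * (x * (x * X)) * (+ 1 - x * X) + M * X * + 1 * (+ 1 - x * (x * X)))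
          ≡ M * X * (Q + x * X) * (+ 1 - x * (x * (x * X))) + M * X * (+ 1 + x - x * (x * (x * X))) * ((x - + 1) * Q - (x * X - + 1))
        lemma = solve-∀
adjacent-step-identity-cases x M Q X false false false rel _ _ = by-relation (x * (x * (M * X))) _ _ (lemma x M Q X) rel
  where lemma : ∀ x M Q X →
          + 1 * (M * Q * (+ 1 - x * (x * X)))
            + (+ 1 + x) * (+ 1 * (M * + 1 * (x * X - + 1)) + M * + 1 * (x * (x * X)) * (+ 1 - x * X) + M * + 1 * + 1 * (+ 1 - x * (x * X)))
          ≡ M * + 1 * (Q + x * X) * (+ 1 - x * (x * (x * X))) + x * (x * (M * X)) * ((x - + 1) * Q - (x * X - + 1))
        lemma = solve-∀
adjacent-step-identity-cases x M Q X true false false _ tf⇒t _ with tf⇒t refl refl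
... | ()
adjacent-step-identity-cases x M Q X false true true _ _ ft⇒f with ft⇒f refl refl
... | ()

adjacent-step-identity : ∀ (x M Q X D : ℤ) (α β e : Bool) → (x - + 1) * Q ≡ x * X - + 1 → (+ 1 + x) * D ≡ M * Q * (+ 1 - x * (x * X)) →
  (α ≡ true → β ≡ false → e ≡ true) → (α ≡ false → β ≡ true → e ≡ false) →
  (+ 1 + x) * (ifElse1 e (x * (x * X)) * (D + M * ifElse1 α X * (x * X - + 1))
               + M * ifElse1 α X * ifElse1 (not β) (x * (x * X)) * (+ 1 - x * X)
               + M * ifElse1 e X * ifElse1 β (x * X) * (+ 1 - x * (x * X)))
  ≡ M * ifElse1 e X * (Q + x * X) * (+ 1 - x * (x * (x * X)))
adjacent-step-identity x M Q X D α β e rel IH tf⇒t ft⇒f =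
  trans (distrib x E D R₁ R₂ R₃)
    (trans (cong (λ t → E * t + (+ 1 + x) * (E * R₁ + R₂ + R₃)) IH)
      (adjacent-step-identity-cases x M Q X α β e rel tf⇒t ft⇒f))
  where
  E = ifElse1 e (x * (x * X))
  R₁ = M * ifElse1 α X * (x * X - + 1)
  R₂ = M * ifElse1 α X * ifElse1 (not β) (x * (x * X)) * (+ 1 - x * X)
  R₃ = M * ifElse1 e X * ifElse1 β (x * X) * (+ 1 - x * (x * X))
  distrib : ∀ x E D R₁ R₂ R₃ → (+ 1 + x) * (E * (D + R₁) + R₂ + R₃) ≡ E * ((+ 1 + x) * D) + (+ 1 + x) * (E * R₁ + R₂ + R₃)
  distrib = solve-∀

SameSide : ℤ → ℤ → ℤ → Set
SameSide a b z = (¬ z ≡ a) × (¬ z ≡ b) × (ltB z a ≡ ltB z b) × (ltB a z ≡ ltB b z)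

SameSideOr≡ : ℤ → ℤ → ℤ → Set
SameSideOr≡ a b z = z ≡ a ⊎ SameSide a b z

-- Exchanging a and b changes no comparison with a letter lying on the same side of both,
-- so it preserves every descent that does not involve the pair itself.
module SwapTwins (a b : ℤ) (b≢a : ¬ b ≡ a) where
  h = relabel a b b a
  ha : h a ≡ b
  ha = relabel-a a b b a
  hb : h b ≡ a
  hb = relabel-b a b b a b≢a
  hz : ∀ z → SameSide a b z → h z ≡ z
  hz z (na , nb , _) = relabel-other a b b a z na nb

  h-keepsOrder : ∀ u v → SameSideOr≡ a b u → SameSideOr≡ a b v → KeepsOrder h u v
  h-keepsOrder u v (inj₁ refl) (inj₁ refl) rewrite ha | ltB-irrefl b | ltB-irrefl a = refl
  h-keepsOrder u v (inj₁ refl) (inj₂ gv) rewrite ha | hz v gv = sym (proj₁ (proj₂ (proj₂ gv)))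
  h-keepsOrder u v (inj₂ gu) (inj₁ refl) rewrite ha | hz u gu = sym (proj₂ (proj₂ (proj₂ gu)))
  h-keepsOrder u v (inj₂ gu) (inj₂ gv) rewrite hz u gu | hz v gv = refl

  h-keepsOrder-y-b : ∀ y → SameSide a b y → KeepsOrder h y b
  h-keepsOrder-y-b y gy rewrite hb | hz y gy = proj₂ (proj₂ (proj₂ gy))

  h-keepsOrder-b-v : ∀ v → SameSide a b v → KeepsOrder h b v
  h-keepsOrder-b-v v gv rewrite hb | hz v gv = proj₁ (proj₂ (proj₂ gv))

  keepsDescents-b∷ : ∀ r → All (SameSide a b) r → KeepsDescents h (b ∷ r)
  keepsDescents-b∷ [] _ = tt
  keepsDescents-b∷ (v ∷ r) (gv ∷ gr) = h-keepsOrder-b-v v gv , keepsDescents h-keepsOrder (v ∷ r) (All.map inj₂ (gv ∷ gr))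

  keepsDescents-y∷b∷ : ∀ l y r → All (SameSideOr≡ a b) l → SameSide a b y → All (SameSide a b) r → KeepsDescents h (l ++ y ∷ b ∷ r)
  keepsDescents-y∷b∷ [] y r _ gy gr = h-keepsOrder-y-b y gy , keepsDescents-b∷ r gr
  keepsDescents-y∷b∷ (t ∷ []) y r (at ∷ []) gy gr = h-keepsOrder t y at (inj₂ gy) , keepsDescents-y∷b∷ [] y r [] gy gr
  keepsDescents-y∷b∷ (t ∷ t' ∷ l) y r (at ∷ at' ∷ al) gy gr = h-keepsOrder t t' at at' , keepsDescents-y∷b∷ (t' ∷ l) y r (at' ∷ al) gy gr

  swap-cancel : ∀ x w y r → SameSide a b y → All (SameSide a b) w → All (SameSide a b) r →
    ∑ins (λ s τ → s * x ^ᶻ maj (τ ++ y ∷ b ∷ r)) a w ≡ ∑ins (λ s σ → s * x ^ᶻ maj (σ ++ y ∷ a ∷ r)) b w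
  swap-cancel x w y r gy gw gr = sym (trans (cong₂ (∑ins F) (sym ha) (sym h-fixes-w)) (trans (∑ins-map F h a w)
      (∑ins-cong-All {P = SameSideOr≡ a b} a w (inj₁ refl) (All.map inj₂ gw) pointwise)))
    where
    F : ℤ → List ℤ → ℤ
    F s σ = s * x ^ᶻ maj (σ ++ y ∷ a ∷ r)
    h-fixes-w : map h w ≡ w
    h-fixes-w = map-relabel-id a b b a w (All.map (λ { (na , nb , _) → na , nb }) gw)
    h-fixes-r : map h r ≡ r
    h-fixes-r = map-relabel-id a b b a r (All.map (λ { (na , nb , _) → na , nb }) gr)
    pointwise : ∀ s u → All (SameSideOr≡ a b) u → F s (map h u) ≡ s * x ^ᶻ maj (u ++ y ∷ b ∷ r)
    pointwise s u au = cong (λ t → s * x ^ᶻ t) (trans (cong maj eqw) (majFrom-map h 1 (u ++ y ∷ b ∷ r) (keepsDescents-y∷b∷ u y r au gy gr)))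
      where
      eqw : map h u ++ y ∷ a ∷ r ≡ map h (u ++ y ∷ b ∷ r)
      eqw = sym (trans (LP.map-++ h u (y ∷ b ∷ r)) (cong (map h u ++_) (cong₂ _∷_ (hz y gy) (cong₂ _∷_ hb h-fixes-r))))

∑ins²-cong-length : ∀ (G G' : List ℤ → ℤ) a b w → (∀ σ → length σ ≡ suc (suc (length w)) → G σ ≡ G' σ) → ∑ins² G a b w ≡ ∑ins² G' a b w
∑ins²-cong-length G G' a b w e = ∑ins-cong-length a w (λ s1 τ lτ → ∑ins-cong-length b τ (λ s2 σ lσ → cong (λ t → s1 * s2 * t) (e σ (trans lσ (cong suc lτ)))))

∑ins²-scale : ∀ k (G : List ℤ → ℤ) a b w → ∑ins² (λ σ → k * G σ) a b w ≡ k * ∑ins² G a b w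
∑ins²-scale k G a b w = trans (∑ins-cong a w (λ s1 τ → trans (∑ins-cong b τ (λ s2 σ → l s1 s2 k (G σ))) (∑ins-scale k (λ s2 σ → s1 * s2 * G σ) b τ)))
                           (∑ins-scale k (λ s1 τ → ∑ins (λ s2 σ → s1 * s2 * G σ) b τ) a w)
  where l : ∀ s1 s2 k g → s1 * s2 * (k * g) ≡ k * (s1 * s2 * g)
        l = solve-∀

∑ins²-snoc-cancel : ∀ (G : List ℤ → ℤ) a b w y → ∑ins (λ s τ → s * G (τ ++ y ∷ b ∷ [])) a w ≡ ∑ins (λ s σ → s * G (σ ++ y ∷ a ∷ [])) b w →
  ∑ins² G a b (w ∷ʳ y) ≡ ∑ins² (λ σ → G (σ ∷ʳ y)) a b w - G (w ++ y ∷ b ∷ a ∷ []) + G (w ++ y ∷ a ∷ b ∷ [])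
∑ins²-snoc-cancel G a b w y a-early≡b-early =
  trans (∑ins²-snoc G a b w y)
    (trans (cong (λ t → D - t + B - Gba + Gab) a-early≡b-early) (lemma D B Gba Gab))
  where
  D = ∑ins² (λ σ → G (σ ∷ʳ y)) a b w
  B = ∑ins (λ s σ → s * G (σ ++ y ∷ a ∷ [])) b w
  Gba = G (w ++ y ∷ b ∷ a ∷ [])
  Gab = G (w ++ y ∷ a ∷ b ∷ [])
  lemma : ∀ D B p q → D - B + B - p + q ≡ D - p + q
  lemma = solve-∀

module Adjacent (x a b : ℤ) (a<b : ltB a b ≡ true) (b≢a : ¬ b ≡ a) where
  open SwapTwins a b b≢a
  G : List ℤ → ℤ
  G σ = x ^ᶻ maj σ
  D : List ℤ → ℤ
  D w = ∑ins² G a b w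
  b≮a : ltB b a ≡ false
  b≮a = ltB-asym a b a<b

  ClosedForm : List ℤ → Set
  ClosedForm w = (+ 1 + x) * D w ≡ x ^ᶻ maj w * qint (suc (length w)) x * (+ 1 - x ^ᶻ suc (suc (length w)))

  closed-[] : ClosedForm []
  closed-[] rewrite a<b | b≮a = l x
    where l : ∀ x → (+ 1 + x) * (+ 1 * -[1+ 0 ] * (x * + 1) + + 1 * + 1 * + 1) ≡ + 1 * (+ 1 + + 0) * (+ 1 - x * (x * + 1))
          l = solve-∀

  b<y : ∀ y → SameSide a b y → ∀ β → ltB a y ≡ β → ltB b y ≡ β
  b<y y gy β e = trans (sym (proj₂ (proj₂ (proj₂ gy)))) e
  y<a : ∀ y → SameSide a b y → ∀ β → ltB a y ≡ β → ltB y a ≡ not β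
  y<a y gy β e = trans (ltB-not y a (proj₁ gy)) (cong not e)
  y<b : ∀ y → SameSide a b y → ∀ β → ltB a y ≡ β → ltB y b ≡ not β
  y<b y gy β e = trans (sym (proj₁ (proj₂ (proj₂ gy)))) (y<a y gy β e)

  closed-[y] : ∀ y → SameSide a b y → ClosedForm (y ∷ [])
  closed-[y] y gy = trans (cong ((+ 1 + x) *_) (∑ins²-snoc-cancel G a b [] y (swap-cancel x [] y [] gy [] []))) (bcase (ltB a y) refl (b<y y gy _ refl) (y<a y gy _ refl) (y<b y gy _ refl))
    where
    bcase : ∀ β → ltB a y ≡ β → ltB b y ≡ β → ltB y a ≡ not β → ltB y b ≡ not β → (+ 1 + x) * (∑ins² (λ σ → G (σ ∷ʳ y)) a b [] - G (y ∷ b ∷ a ∷ []) + G (y ∷ a ∷ b ∷ []))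
                                   ≡ x ^ᶻ maj (y ∷ []) * qint 2 x * (+ 1 - x ^ᶻ 3)
    bcase β e e3 e1 e2 rewrite a<b | b≮a | e | e3 | e1 | e2 = finb β
      where
      finb : ∀ β → (+ 1 + x) * (+ 1 * -[1+ 0 ] * x ^ᶻ (1 ℕ.+ (ifElse0ᴺ (not β) 2 ℕ.+ 0)) + + 1 * + 1 * x ^ᶻ (0 ℕ.+ (ifElse0ᴺ (not β) 2 ℕ.+ 0))
                  - x ^ᶻ (ifElse0ᴺ β 1 ℕ.+ (2 ℕ.+ 0)) + x ^ᶻ (ifElse0ᴺ β 1 ℕ.+ (0 ℕ.+ 0)))
                ≡ x ^ᶻ 0 * qint 2 x * (+ 1 - x ^ᶻ 3)
      finb true = l x
        where l : ∀ x → (+ 1 + x) * (+ 1 * -[1+ 0 ] * (x * + 1) + + 1 * + 1 * + 1 - x * (x * (x * + 1)) + x * + 1)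
                          ≡ + 1 * (+ 1 + (x * + 1 + + 0)) * (+ 1 - x * (x * (x * + 1)))
              l = solve-∀
      finb false = l x
        where l : ∀ x → (+ 1 + x) * (+ 1 * -[1+ 0 ] * (x * (x * (x * + 1))) + + 1 * + 1 * (x * (x * + 1)) - x * (x * + 1) + + 1)
                          ≡ + 1 * (+ 1 + (x * + 1 + + 0)) * (+ 1 - x * (x * (x * + 1)))
              l = solve-∀

  module Snoc (w1 : List ℤ) (z y : ℤ) (g : All (SameSide a b) ((w1 ∷ʳ z) ∷ʳ y)) (IH : ClosedForm (w1 ∷ʳ z)) where
    private
      w0 = w1 ∷ʳ z
      m = length w1
      same-w0 = AllP.++⁻ˡ w0 g
      same-y : SameSide a b y
      same-y = All.head (AllP.++⁻ʳ w0 g)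
      same-w1 = AllP.++⁻ˡ w1 same-w0
      same-z : SameSide a b z
      same-z = All.head (AllP.++⁻ʳ w1 same-w0)
      length-w0 : length w0 ≡ suc m
      length-w0 = length-∷ʳ w1 z
      G1 : List ℤ → ℤ
      G1 σ = G (σ ∷ʳ y)
      M = x ^ᶻ maj w0
      X = x ^ᶻ suc m
      Q = qint (suc (suc m)) x
      α = ltB a z
      β = ltB a y
      e = ltB y z
      b<z≡α : ltB b z ≡ α
      b<z≡α = sym (proj₂ (proj₂ (proj₂ same-z)))
      b<y≡β : ltB b y ≡ β
      b<y≡β = sym (proj₂ (proj₂ (proj₂ same-y)))
      y<a≡¬β : ltB y a ≡ not β
      y<a≡¬β = ltB-not y a (proj₁ same-y)
      y<b≡¬β : ltB y b ≡ not β
      y<b≡¬β = trans (sym (proj₁ (proj₂ (proj₂ same-y)))) y<a≡¬β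
      maj-za : maj (w1 ++ z ∷ a ∷ []) ≡ maj w0 ℕ.+ ifElse0ᴺ α (suc m)
      maj-za = majFrom-snoc 1 w1 z a
      maj-zb : maj (w1 ++ z ∷ b ∷ []) ≡ maj w0 ℕ.+ ifElse0ᴺ α (suc m)
      maj-zb = trans (majFrom-snoc 1 w1 z b) (cong (λ t → maj w0 ℕ.+ ifElse0ᴺ t (suc m)) b<z≡α)
      maj-zy : maj (w0 ∷ʳ y) ≡ maj w0 ℕ.+ ifElse0ᴺ e (suc m)
      maj-zy = trans (cong maj (∷ʳ-∷ʳ w1 z y)) (majFrom-snoc 1 w1 z y)
      maj-zab : maj (w1 ++ z ∷ a ∷ b ∷ []) ≡ maj w0 ℕ.+ ifElse0ᴺ α (suc m)
      maj-zab = trans (cong maj (∷ʳ-++ w1 z (a ∷ b ∷ []))) (trans (majFrom-snoc 1 w0 a b) (trans (cong (λ t → maj (w0 ∷ʳ a) ℕ.+ ifElse0ᴺ t (suc (length w0))) b≮a)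
             (trans (ℕP.+-identityʳ _) (trans (cong maj (∷ʳ-∷ʳ w1 z a)) maj-za))))
      maj-zba : maj (w1 ++ z ∷ b ∷ a ∷ []) ≡ maj w0 ℕ.+ ifElse0ᴺ α (suc m) ℕ.+ ifElse0ᴺ true (suc (suc m))
      maj-zba = trans (cong maj (∷ʳ-++ w1 z (b ∷ a ∷ []))) (trans (majFrom-snoc 1 w0 b a)
             (cong₂ ℕ._+_ (trans (cong maj (∷ʳ-∷ʳ w1 z b)) maj-zb) (trans (cong (λ t → ifElse0ᴺ t (suc (length w0))) a<b) (cong suc length-w0))))
      length-w0∷ʳ : ∀ p → length (w0 ∷ʳ p) ≡ suc (suc m)
      length-w0∷ʳ p = trans (length-∷ʳ w0 p) (cong suc length-w0)
      maj-zaby : maj ((w1 ++ z ∷ a ∷ b ∷ []) ∷ʳ y) ≡ maj w0 ℕ.+ ifElse0ᴺ α (suc m) ℕ.+ ifElse0ᴺ (not β) (suc (suc (suc m)))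
      maj-zaby = trans (cong maj (∷ʳ-++-∷ʳ w1 z a b y)) (trans (majFrom-snoc 1 (w0 ∷ʳ a) b y)
             (cong₂ ℕ._+_ (trans (cong maj (∷ʳ-∷ʳ-∷ʳ w1 z a b)) maj-zab) (cong₂ (λ t l → ifElse0ᴺ t (suc l)) y<b≡¬β (length-w0∷ʳ a))))
      maj-zbay : maj ((w1 ++ z ∷ b ∷ a ∷ []) ∷ʳ y) ≡ maj w0 ℕ.+ ifElse0ᴺ α (suc m) ℕ.+ ifElse0ᴺ true (suc (suc m)) ℕ.+ ifElse0ᴺ (not β) (suc (suc (suc m)))
      maj-zbay = trans (cong maj (∷ʳ-++-∷ʳ w1 z b a y)) (trans (majFrom-snoc 1 (w0 ∷ʳ b) a y)
             (cong₂ ℕ._+_ (trans (cong maj (∷ʳ-∷ʳ-∷ʳ w1 z b a)) maj-zba) (cong₂ (λ t l → ifElse0ᴺ t (suc l)) y<a≡¬β (length-w0∷ʳ b))))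
      maj-yab : maj (w0 ++ y ∷ a ∷ b ∷ []) ≡ maj w0 ℕ.+ ifElse0ᴺ e (suc m) ℕ.+ ifElse0ᴺ β (suc (suc m))
      maj-yab = trans (cong maj (∷ʳ-++ w0 y (a ∷ b ∷ []))) (trans (majFrom-snoc 1 (w0 ∷ʳ y) a b) (trans (cong (λ t → maj ((w0 ∷ʳ y) ∷ʳ a) ℕ.+ ifElse0ᴺ t (suc (length (w0 ∷ʳ y)))) b≮a)
             (trans (ℕP.+-identityʳ _) (trans (cong maj (∷ʳ-∷ʳ w0 y a)) (trans (majFrom-snoc 1 w0 y a)
               (cong₂ (λ t l → t ℕ.+ ifElse0ᴺ β (suc l)) maj-zy length-w0))))))
      maj-yba : maj (w0 ++ y ∷ b ∷ a ∷ []) ≡ maj w0 ℕ.+ ifElse0ᴺ e (suc m) ℕ.+ ifElse0ᴺ β (suc (suc m)) ℕ.+ ifElse0ᴺ true (suc (suc (suc m)))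
      maj-yba = trans (cong maj (∷ʳ-++ w0 y (b ∷ a ∷ []))) (trans (majFrom-snoc 1 (w0 ∷ʳ y) b a)
             (cong₂ ℕ._+_ (trans (cong maj (∷ʳ-∷ʳ w0 y b)) (trans (majFrom-snoc 1 w0 y b) (trans (cong₂ (λ t u → t ℕ.+ ifElse0ᴺ (ltB b y) (suc u)) maj-zy length-w0) (cong (λ l → maj w0 ℕ.+ ifElse0ᴺ e (suc m) ℕ.+ ifElse0ᴺ l (suc (suc m))) b<y≡β))))
                          (cong₂ (λ t l → ifElse0ᴺ t (suc l)) a<b (length-w0∷ʳ y))))
      A' = ifElse1 α X
      C = ifElse1 (not β) (x * (x * X))
      Ei = ifElse1 e X
      Bi = ifElse1 β (x * X)
      P3 = x * (x * X)
      G-zab : G (w1 ++ z ∷ a ∷ b ∷ []) ≡ M * A'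
      G-zab = trans (cong (x ^ᶻ_) maj-zab) (^ᶻ-+-ifElse0 x (maj w0) α (suc m))
      G-zba : G (w1 ++ z ∷ b ∷ a ∷ []) ≡ M * A' * (x * X)
      G-zba = trans (cong (x ^ᶻ_) maj-zba) (^ᶻ-+-ifElse0₂ x (maj w0) α (suc m) true (suc (suc m)))
      G-zaby : G1 (w1 ++ z ∷ a ∷ b ∷ []) ≡ M * A' * C
      G-zaby = trans (cong (x ^ᶻ_) maj-zaby) (^ᶻ-+-ifElse0₂ x (maj w0) α (suc m) (not β) (suc (suc (suc m))))
      G-zbay : G1 (w1 ++ z ∷ b ∷ a ∷ []) ≡ M * A' * (x * X) * C
      G-zbay = trans (cong (x ^ᶻ_) maj-zbay) (^ᶻ-+-ifElse0₃ x (maj w0) α (suc m) true (suc (suc m)) (not β) (suc (suc (suc m))))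
      G-yab : G (w0 ++ y ∷ a ∷ b ∷ []) ≡ M * Ei * Bi
      G-yab = trans (cong (x ^ᶻ_) maj-yab) (^ᶻ-+-ifElse0₂ x (maj w0) e (suc m) β (suc (suc m)))
      G-yba : G (w0 ++ y ∷ b ∷ a ∷ []) ≡ M * Ei * Bi * P3
      G-yba = trans (cong (x ^ᶻ_) maj-yba) (^ᶻ-+-ifElse0₃ x (maj w0) e (suc m) β (suc (suc m)) true (suc (suc (suc m))))
      DGz = ∑ins² (λ σ → G (σ ∷ʳ z)) a b w1
      Ey = ifElse1 e P3
      D-y : D (w0 ∷ʳ y) ≡ ∑ins² G1 a b w0 - G (w0 ++ y ∷ b ∷ a ∷ []) + G (w0 ++ y ∷ a ∷ b ∷ [])
      D-y = ∑ins²-snoc-cancel G a b w0 y (swap-cancel x w0 y [] same-y same-w0 [])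
      swap-cancel-y : ∑ins (λ s τ → s * G1 (τ ++ z ∷ b ∷ [])) a w1 ≡ ∑ins (λ s σ → s * G1 (σ ++ z ∷ a ∷ [])) b w1
      swap-cancel-y = trans (∑ins-cong a w1 (λ s τ → cong (λ t → s * x ^ᶻ maj t) (LP.++-assoc τ (z ∷ b ∷ []) (y ∷ []))))
                (trans (swap-cancel x w1 z (y ∷ []) same-z same-w1 (same-y ∷ []))
                   (sym (∑ins-cong b w1 (λ s σ → cong (λ t → s * x ^ᶻ maj t) (LP.++-assoc σ (z ∷ a ∷ []) (y ∷ []))))))
      D₁-z : ∑ins² G1 a b w0 ≡ ∑ins² (λ σ → G1 (σ ∷ʳ z)) a b w1 - G1 (w1 ++ z ∷ b ∷ a ∷ []) + G1 (w1 ++ z ∷ a ∷ b ∷ [])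
      D₁-z = ∑ins²-snoc-cancel G1 a b w1 z swap-cancel-y
      D₁-scale : ∑ins² (λ σ → G1 (σ ∷ʳ z)) a b w1 ≡ Ey * DGz
      D₁-scale = trans (∑ins²-cong-length (λ σ → G1 (σ ∷ʳ z)) (λ σ → Ey * G (σ ∷ʳ z)) a b w1 append-y)
                       (∑ins²-scale Ey (λ σ → G (σ ∷ʳ z)) a b w1)
        where
        append-y : ∀ σ → length σ ≡ suc (suc m) → G ((σ ∷ʳ z) ∷ʳ y) ≡ Ey * G (σ ∷ʳ z)
        append-y σ length-σ = trans (^ᶻ-maj-∷ʳ x σ z y) (cong (λ k → ifElse1 e (x ^ᶻ suc k) * G (σ ∷ʳ z)) length-σ)
      D-z : D w0 ≡ DGz - G (w1 ++ z ∷ b ∷ a ∷ []) + G (w1 ++ z ∷ a ∷ b ∷ [])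
      D-z = ∑ins²-snoc-cancel G a b w1 z (swap-cancel x w1 z [] same-z same-w1 [])
      DGz≡ : DGz ≡ D w0 + G (w1 ++ z ∷ b ∷ a ∷ []) - G (w1 ++ z ∷ a ∷ b ∷ [])
      DGz≡ = sym (trans (cong (λ t → t + G (w1 ++ z ∷ b ∷ a ∷ []) - G (w1 ++ z ∷ a ∷ b ∷ [])) D-z) (l DGz _ _))
        where l : ∀ d p q → d - p + q + p - q ≡ d
              l = solve-∀
      IH' : (+ 1 + x) * D w0 ≡ M * Q * (+ 1 - x * (x * X))
      IH' = trans IH (cong (λ l → M * qint (suc l) x * (+ 1 - x ^ᶻ suc (suc l))) length-w0)
      D0 = D w0
      Φ : ℤ → ℤ → ℤ → ℤ → ℤ → ℤ → ℤ
      Φ p1 p2 p3 p4 p5 p6 = Ey * (D0 + p2 - p1) - p4 + p3 - p6 + p5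
      Φ-cong : ∀ {p1 q1 p2 q2 p3 q3 p4 q4 p5 q5 p6 q6} → p1 ≡ q1 → p2 ≡ q2 → p3 ≡ q3 → p4 ≡ q4 → p5 ≡ q5 → p6 ≡ q6 → Φ p1 p2 p3 p4 p5 p6 ≡ Φ q1 q2 q3 q4 q5 q6
      Φ-cong refl refl refl refl refl refl = refl
      D-expanded : D (w0 ∷ʳ y) ≡ Φ (M * A') (M * A' * (x * X)) (M * A' * C) (M * A' * (x * X) * C) (M * Ei * Bi) (M * Ei * Bi * P3)
      D-expanded = begin
        D (w0 ∷ʳ y) ≡⟨ D-y ⟩
        ∑ins² G1 a b w0 - G (w0 ++ y ∷ b ∷ a ∷ []) + G (w0 ++ y ∷ a ∷ b ∷ []) ≡⟨ cong (λ t → t - G (w0 ++ y ∷ b ∷ a ∷ []) + G (w0 ++ y ∷ a ∷ b ∷ [])) D₁-z ⟩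
        ∑ins² (λ σ → G1 (σ ∷ʳ z)) a b w1 - G1 (w1 ++ z ∷ b ∷ a ∷ []) + G1 (w1 ++ z ∷ a ∷ b ∷ []) - G (w0 ++ y ∷ b ∷ a ∷ []) + G (w0 ++ y ∷ a ∷ b ∷ [])
          ≡⟨ cong (λ t → t - G1 (w1 ++ z ∷ b ∷ a ∷ []) + G1 (w1 ++ z ∷ a ∷ b ∷ []) - G (w0 ++ y ∷ b ∷ a ∷ []) + G (w0 ++ y ∷ a ∷ b ∷ [])) (trans D₁-scale (cong (Ey *_) DGz≡)) ⟩
        Φ (G (w1 ++ z ∷ a ∷ b ∷ [])) (G (w1 ++ z ∷ b ∷ a ∷ [])) (G1 (w1 ++ z ∷ a ∷ b ∷ [])) (G1 (w1 ++ z ∷ b ∷ a ∷ [])) (G (w0 ++ y ∷ a ∷ b ∷ [])) (G (w0 ++ y ∷ b ∷ a ∷ []))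
          ≡⟨ Φ-cong G-zab G-zba G-zaby G-zbay G-yab G-yba ⟩
        Φ (M * A') (M * A' * (x * X)) (M * A' * C) (M * A' * (x * X) * C) (M * Ei * Bi) (M * Ei * Bi * P3) ∎
        where open ≡-Reasoning
      rhs≡ : x ^ᶻ maj (w0 ∷ʳ y) * qint (suc (length (w0 ∷ʳ y))) x * (+ 1 - x ^ᶻ suc (suc (length (w0 ∷ʳ y))))
             ≡ M * Ei * (Q + x * X) * (+ 1 - x * (x * (x * X)))
      rhs≡ = cong₂ _*_ (cong₂ _*_ (trans (cong (x ^ᶻ_) maj-zy) (^ᶻ-+-ifElse0 x (maj w0) e (suc m))) (trans (cong (λ l → qint (suc l) x) (length-w0∷ʳ y)) (qint-suc (suc (suc m)) x)))
                       (cong (λ l → + 1 - x ^ᶻ suc (suc l)) (length-w0∷ʳ y))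
      α∧¬β⇒e : α ≡ true → β ≡ false → e ≡ true
      α∧¬β⇒e p q = ltB-trans y a z (ltB-flip a y (λ r → proj₁ same-y (sym r)) q) p
      ¬α∧β⇒¬e : α ≡ false → β ≡ true → e ≡ false
      ¬α∧β⇒¬e p q = ltB-asym z y (ltB-trans z a y (ltB-flip a z (λ r → proj₁ same-z (sym r)) p) q)

    closed : ClosedForm ((w1 ∷ʳ z) ∷ʳ y)
    closed = begin
      (+ 1 + x) * D (w0 ∷ʳ y) ≡⟨ cong ((+ 1 + x) *_) D-expanded ⟩
      (+ 1 + x) * Φ (M * A') (M * A' * (x * X)) (M * A' * C) (M * A' * (x * X) * C) (M * Ei * Bi) (M * Ei * Bi * P3) ≡⟨ regroup x Ey D0 M A' C Ei Bi X ⟩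
      (+ 1 + x) * (Ey * (D0 + M * A' * (x * X - + 1)) + M * A' * C * (+ 1 - x * X) + M * Ei * Bi * (+ 1 - x * (x * X)))
        ≡⟨ adjacent-step-identity x M Q X D0 α β e (qint-geometric (suc (suc m)) x) IH' α∧¬β⇒e ¬α∧β⇒¬e ⟩
      M * Ei * (Q + x * X) * (+ 1 - x * (x * (x * X))) ≡⟨ sym rhs≡ ⟩
      x ^ᶻ maj (w0 ∷ʳ y) * qint (suc (length (w0 ∷ʳ y))) x * (+ 1 - x ^ᶻ suc (suc (length (w0 ∷ʳ y)))) ∎
      where
      open ≡-Reasoning
      regroup : ∀ x Ey D0 M A' C Ei Bi X → (+ 1 + x) * (Ey * (D0 + M * A' * (x * X) - M * A') - M * A' * (x * X) * C + M * A' * C - M * Ei * Bi * (x * (x * X)) + M * Ei * Bi)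
             ≡ (+ 1 + x) * (Ey * (D0 + M * A' * (x * X - + 1)) + M * A' * C * (+ 1 - x * X) + M * Ei * Bi * (+ 1 - x * (x * X)))
      regroup = solve-∀

  ∑ins²-adjacent : ∀ w → All (SameSide a b) w → ClosedForm w
  ∑ins²-adjacent w g = go (reverseView w) g
    where
    go : ∀ {w} → Reverse w → All (SameSide a b) w → ClosedForm w
    go [] _ = closed-[]
    go (.[] ∶ [] ∶ʳ y) (gy ∷ []) = closed-[y] y gy
    go (.(w1 ∷ʳ z) ∶ r0@(w1 ∶ r1 ∶ʳ z) ∶ʳ y) g = Snoc.closed w1 z y g (go r0 (AllP.++⁻ˡ (w1 ∷ʳ z) g))

Letter : ℕ → ℤ → Set
Letter n (+ zero) = ⊥
Letter n (+ suc k) = k ℕ.< n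
Letter n -[1+ k ] = k ℕ.< n

Letter-suc : ∀ {n z} → Letter n z → Letter (suc n) z
Letter-suc {n} {+ zero} ()
Letter-suc {n} {+ suc k} p = ℕP.m<n⇒m<1+n p
Letter-suc {n} { -[1+ k ] } p = ℕP.m<n⇒m<1+n p

Letter⁺≢ : ∀ {n m k} → n ℕ.≤ m → k ℕ.< n → ¬ (+ suc k) ≡ + suc m
Letter⁺≢ le p e = ℕP.<-irrefl (ℕP.suc-injective (ℤP.+-injective e)) (ℕP.<-≤-trans p le)

Letter⁻≢ : ∀ {n m k} → n ℕ.≤ m → k ℕ.< n → ¬ -[1+ k ] ≡ -[1+ m ]
Letter⁻≢ le p e = ℕP.<-irrefl (ℤP.-[1+-injective e) (ℕP.<-≤-trans p le)

sameSide⁺ : ∀ n z → Letter n z → SameSide (+ suc n) (+ suc (suc n)) z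
sameSide⁺ n (+ zero) ()
sameSide⁺ n (+ suc k) p = Letter⁺≢ ℕP.≤-refl p , Letter⁺≢ (ℕP.n≤1+n n) p ,
  trans (<⇒<ᵇ≡true p) (sym (<⇒<ᵇ≡true (ℕP.m<n⇒m<1+n p))) , trans (>⇒<ᵇ≡false p) (sym (>⇒<ᵇ≡false (ℕP.m<n⇒m<1+n p)))
sameSide⁺ n -[1+ k ] p = (λ ()) , (λ ()) , refl , refl

sameSide⁻ : ∀ n z → Letter n z → SameSide (-[1+ n ]) (-[1+ suc n ]) z
sameSide⁻ n (+ zero) ()
sameSide⁻ n (+ suc k) p = (λ ()) , (λ ()) , refl , refl
sameSide⁻ n -[1+ k ] p = Letter⁻≢ ℕP.≤-refl p , Letter⁻≢ (ℕP.n≤1+n n) p ,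
  trans (<⇒<ᵇ≡true p) (sym (<⇒<ᵇ≡true (ℕP.m<n⇒m<1+n p))) , trans (>⇒<ᵇ≡false p) (sym (>⇒<ᵇ≡false (ℕP.m<n⇒m<1+n p)))

∑ins²-cong-All : ∀ {P : ℤ → Set} (G G' : List ℤ → ℤ) a b w → P a → P b → All P w → (∀ σ → All P σ → G σ ≡ G' σ) → ∑ins² G a b w ≡ ∑ins² G' a b w
∑ins²-cong-All G G' a b w pa pb pw e = ∑ins-cong-All a w pa pw (λ s1 τ pτ → ∑ins-cong-All b τ pb pτ (λ s2 σ pσ → cong (λ t → s1 * s2 * t) (e σ pσ)))

-- The relabelling n+1 ↦ n+2, -(n+2) ↦ -(n+1) preserves the relative order of all letters involved,
-- so inserting the pair (n+1, -(n+2)) has the same maj-statistics as inserting (n+2, -(n+1));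
-- antisymmetry of ∑ins² in its two letters then makes the two mixed insertions cancel.
module Mixed (n : ℕ) where
  a = + suc n
  b = -[1+ suc n ]
  a' = -[1+ n ]
  b' = + suc (suc n)
  h = relabel a b' b a'
  ha : h a ≡ b'
  ha = relabel-a a b' b a'
  hb : h b ≡ a'
  hb = relabel-b a b' b a' (λ ())
  Involved : ℤ → Set
  Involved z = z ≡ a ⊎ z ≡ b ⊎ Letter n z
  Letter≢a : ∀ {z} → Letter n z → ¬ z ≡ a
  Letter≢a {+ zero} ()
  Letter≢a {+ suc k} p = Letter⁺≢ ℕP.≤-refl p
  Letter≢a { -[1+ k ] } p = λ ()
  Letter≢b : ∀ {z} → Letter n z → ¬ z ≡ b
  Letter≢b {+ zero} ()
  Letter≢b {+ suc k} p = λ ()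
  Letter≢b { -[1+ k ] } p = Letter⁻≢ (ℕP.n≤1+n n) p
  hz : ∀ z → Letter n z → h z ≡ z
  hz z p = relabel-other a b' b a' z (Letter≢a p) (Letter≢b p)

  h-keepsOrder : ∀ u v → Involved u → Involved v → KeepsOrder h u v
  h-keepsOrder u v (inj₁ refl) (inj₁ refl) rewrite ha | ltB-irrefl b' = refl
  h-keepsOrder u v (inj₂ (inj₁ refl)) (inj₂ (inj₁ refl)) rewrite hb | ltB-irrefl a' = refl
  h-keepsOrder u v (inj₁ refl) (inj₂ (inj₁ refl)) rewrite ha | hb = refl
  h-keepsOrder u v (inj₂ (inj₁ refl)) (inj₁ refl) rewrite ha | hb = refl
  h-keepsOrder u (+ zero) (inj₁ refl) (inj₂ (inj₂ ()))
  h-keepsOrder u (+ suc k) (inj₁ refl) (inj₂ (inj₂ p)) rewrite ha | hz (+ suc k) p = trans (<⇒<ᵇ≡true (ℕP.m<n⇒m<1+n p)) (sym (<⇒<ᵇ≡true p))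
  h-keepsOrder u -[1+ k ] (inj₁ refl) (inj₂ (inj₂ p)) rewrite ha | hz -[1+ k ] p = refl
  h-keepsOrder (+ zero) v (inj₂ (inj₂ ())) (inj₁ refl)
  h-keepsOrder (+ suc k) v (inj₂ (inj₂ p)) (inj₁ refl) rewrite ha | hz (+ suc k) p = trans (>⇒<ᵇ≡false (ℕP.m<n⇒m<1+n p)) (sym (>⇒<ᵇ≡false p))
  h-keepsOrder -[1+ k ] v (inj₂ (inj₂ p)) (inj₁ refl) rewrite ha | hz -[1+ k ] p = refl
  h-keepsOrder u (+ zero) (inj₂ (inj₁ refl)) (inj₂ (inj₂ ()))
  h-keepsOrder u (+ suc k) (inj₂ (inj₁ refl)) (inj₂ (inj₂ p)) rewrite hb | hz (+ suc k) p = refl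
  h-keepsOrder u -[1+ k ] (inj₂ (inj₁ refl)) (inj₂ (inj₂ p)) rewrite hb | hz -[1+ k ] p = trans (<⇒<ᵇ≡true p) (sym (<⇒<ᵇ≡true (ℕP.m<n⇒m<1+n p)))
  h-keepsOrder (+ zero) v (inj₂ (inj₂ ())) (inj₂ (inj₁ refl))
  h-keepsOrder (+ suc k) v (inj₂ (inj₂ p)) (inj₂ (inj₁ refl)) rewrite hb | hz (+ suc k) p = refl
  h-keepsOrder -[1+ k ] v (inj₂ (inj₂ p)) (inj₂ (inj₁ refl)) rewrite hb | hz -[1+ k ] p = trans (>⇒<ᵇ≡false p) (sym (>⇒<ᵇ≡false (ℕP.m<n⇒m<1+n p)))
  h-keepsOrder u v (inj₂ (inj₂ p)) (inj₂ (inj₂ q)) rewrite hz u p | hz v q = refl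

  ∑ins²-mixed-cancel : ∀ x ρ → All (Letter n) ρ → ∑ins² (λ σ → x ^ᶻ maj σ) a b ρ + ∑ins² (λ σ → x ^ᶻ maj σ) a' b' ρ ≡ + 0
  ∑ins²-mixed-cancel x ρ pρ = trans (cong (λ t → ∑ins² G a b ρ + t) (trans (∑ins²-swap G a' b' ρ) (cong -_ e))) (ℤP.+-inverseʳ (∑ins² G a b ρ))
    where
    G : List ℤ → ℤ
    G σ = x ^ᶻ maj σ
    mρ : map h ρ ≡ ρ
    mρ = map-relabel-id a b' b a' ρ (All.map (λ p → Letter≢a p , Letter≢b p) pρ)
    e : ∑ins² G b' a' ρ ≡ ∑ins² G a b ρ
    e = trans (cong₂ (λ p q → ∑ins² G p q ρ) (sym ha) (sym hb)) (trans (cong (∑ins² G (h a) (h b)) (sym mρ))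
          (trans (∑ins²-map G h a b ρ) (∑ins²-cong-All {P = Involved} (λ σ → G (map h σ)) G a b ρ (inj₁ refl) (inj₂ (inj₁ refl))
             (All.map (λ p → inj₂ (inj₂ p)) pρ)
             (λ σ pσ → cong (x ^ᶻ_) (majFrom-map h 1 σ (keepsDescents h-keepsOrder σ pσ))))))

ifElse0 : Bool → ℤ → ℤ
ifElse0 b v = if b then v else + 0

ifElse0-+ : ∀ b u v → ifElse0 b (u + v) ≡ ifElse0 b u + ifElse0 b v
ifElse0-+ true u v = refl
ifElse0-+ false u v = refl

ifElse0-split : ∀ b h v → ifElse0 b v ≡ ifElse0 (b ∧ h) v + ifElse0 (b ∧ not h) v
ifElse0-split true true v = sym (ℤP.+-identityʳ v)
ifElse0-split true false v = sym (ℤP.+-identityˡ v)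
ifElse0-split false h v = refl

∑-cong-All : {A : Set} {P : A → Set} {f g : A → ℤ} (xs : List A) → All P xs → (∀ x → P x → f x ≡ g x) → ∑ f xs ≡ ∑ g xs
∑-cong-All [] [] e = refl
∑-cong-All (x ∷ xs) (letter-case ∷ pxs) e = cong₂ _+_ (e x letter-case) (∑-cong-All xs pxs e)

∑-filter : {A : Set} {P : Pred A 0ℓ} (P? : Decidable P) (f : A → ℤ) (xs : List A) → ∑ f (filter P? xs) ≡ ∑ (λ x → ifElse0 (does (P? x)) (f x)) xs
∑-filter P? f [] = refl
∑-filter P? f (x ∷ xs) with does (P? x)
... | true = cong (λ t → f x + t) (∑-filter P? f xs)
... | false = trans (∑-filter P? f xs) (sym (ℤP.+-identityˡ _))

∑-lists-suc : ∀ k (L : List ℤ) (f : List ℤ → ℤ) → ∑ f (lists (suc k) L) ≡ ∑ (λ x → ∑ (λ u → f (x ∷ u)) (lists k L)) L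
∑-lists-suc k L f = trans (∑-concatMap f (λ x → map (x ∷_) (lists k L)) L) (∑-cong (λ x → ∑-map f (x ∷_) (lists k L)) L)

∑-letters-suc : ∀ n (g : ℤ → ℤ) → ∑ g (letters (suc n)) ≡ ∑ g (letters n) + (g (-[1+ n ]) + g (+ suc n))
∑-letters-suc n g = begin
    ∑ g (map N (upTo (suc n)) ++ map P (upTo (suc n))) ≡⟨ ∑-++ g (map N (upTo (suc n))) (map P (upTo (suc n))) ⟩
    ∑ g (map N (upTo (suc n))) + ∑ g (map P (upTo (suc n))) ≡⟨ cong₂ _+_ (sp N) (sp P) ⟩
    (∑ g (map N (upTo n)) + (g (N n) + + 0)) + (∑ g (map P (upTo n)) + (g (P n) + + 0)) ≡⟨ l (∑ g (map N (upTo n))) (g (N n)) (∑ g (map P (upTo n))) (g (P n)) ⟩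
    (∑ g (map N (upTo n)) + ∑ g (map P (upTo n))) + (g (N n) + g (P n)) ≡⟨ cong (_+ (g (N n) + g (P n))) (sym (∑-++ g (map N (upTo n)) (map P (upTo n)))) ⟩
    ∑ g (letters n) + (g (-[1+ n ]) + g (+ suc n)) ∎
  where
  open ≡-Reasoning
  N : ℕ → ℤ
  N i = -[1+ i ]
  P : ℕ → ℤ
  P i = + suc i
  sp : (h : ℕ → ℤ) → ∑ g (map h (upTo (suc n))) ≡ ∑ g (map h (upTo n)) + (g (h n) + + 0)
  sp h = trans (cong (λ l → ∑ g (map h l)) (sym (LP.upTo-∷ʳ n))) (trans (cong (∑ g) (LP.map-++ h (upTo n) (n ∷ []))) (∑-++ g (map h (upTo n)) (h n ∷ [])))
  l : ∀ a b c d → (a + (b + + 0)) + (c + (d + + 0)) ≡ (a + c) + (b + d)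
  l = solve-∀

lists-All : ∀ {Q : ℤ → Set} k (L : List ℤ) → All Q L → All (All Q) (lists k L)
lists-All zero L qL = [] ∷ []
lists-All (suc k) L qL = AllP.concat⁺ (AllP.map⁺ (All.map (λ qx → AllP.map⁺ (All.map (qx ∷_) (lists-All k L qL))) qL))

letters-Letter : ∀ n → All (Letter n) (letters n)
letters-Letter n = AllP.++⁺ (AllP.map⁺ (AllP.applyUpTo⁺₁ (λ i → i) n (λ p → p))) (AllP.map⁺ (AllP.applyUpTo⁺₁ (λ i → i) n (λ p → p)))

elemᵇ : ℕ → List ℕ → Bool
elemᵇ k [] = false
elemᵇ k (j ∷ l) = (k ℕ.≡ᵇ j) ∨ elemᵇ k l

uniqueᵇ : List ℕ → Bool
uniqueᵇ [] = true
uniqueᵇ (k ∷ l) = not (elemᵇ k l) ∧ uniqueᵇ l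

elemᵇ≡false⇒All≢ : ∀ k l → elemᵇ k l ≡ false → All (λ j → ¬ k ≡ j) l
elemᵇ≡false⇒All≢ k [] _ = []
elemᵇ≡false⇒All≢ k (j ∷ l) e with k ℕ.≡ᵇ j in k≡ᵇj
elemᵇ≡false⇒All≢ k (j ∷ l) () | true
... | false = k≢j ∷ elemᵇ≡false⇒All≢ k l e
  where k≢j : ¬ k ≡ j
        k≢j k≡j with trans (sym k≡ᵇj) (T⇒≡true (ℕP.≡⇒≡ᵇ k j k≡j))
        ... | ()

All≢⇒elemᵇ≡false : ∀ k l → All (λ j → ¬ k ≡ j) l → elemᵇ k l ≡ false
All≢⇒elemᵇ≡false k [] [] = refl
All≢⇒elemᵇ≡false k (j ∷ l) (ne ∷ al) with k ℕ.≡ᵇ j in eq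
... | true = ⊥-elim (ne (ℕP.≡ᵇ⇒≡ k j (subst T (sym eq) tt)))
... | false = All≢⇒elemᵇ≡false k l al

uniqueᵇ-sound : ∀ l → uniqueᵇ l ≡ true → Unique l
uniqueᵇ-sound [] _ = []
uniqueᵇ-sound (k ∷ l) e with elemᵇ k l in k∈ᵇl
uniqueᵇ-sound (k ∷ l) () | true
... | false = elemᵇ≡false⇒All≢ k l k∈ᵇl ∷ uniqueᵇ-sound l e

uniqueᵇ-complete : ∀ l → Unique l → uniqueᵇ l ≡ true
uniqueᵇ-complete [] [] = refl
uniqueᵇ-complete (k ∷ l) (ak ∷ ul) rewrite All≢⇒elemᵇ≡false k l ak = uniqueᵇ-complete l ul

unique?≡uniqueᵇ : ∀ l → does (unique? l) ≡ uniqueᵇ l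
unique?≡uniqueᵇ l with unique? l
... | yes u = sym (uniqueᵇ-complete l u)
... | no nu with uniqueᵇ l in eq
...   | true = ⊥-elim (nu (uniqueᵇ-sound l eq))
...   | false = refl

distinctAbs : List ℤ → Bool
distinctAbs u = uniqueᵇ (map ∣_∣ u)

hasTop : ℕ → List ℤ → Bool
hasTop n [] = false
hasTop n (z ∷ u) = (suc n ℕ.≡ᵇ ∣ z ∣) ∨ hasTop n u

elemᵇ-hasTop : ∀ n u → elemᵇ (suc n) (map ∣_∣ u) ≡ hasTop n u
elemᵇ-hasTop n [] = refl
elemᵇ-hasTop n (z ∷ u) = cong ((suc n ℕ.≡ᵇ ∣ z ∣) ∨_) (elemᵇ-hasTop n u)

≢⇒≡ᵇ≡false : ∀ m n → ¬ m ≡ n → (m ℕ.≡ᵇ n) ≡ false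
≢⇒≡ᵇ≡false m n ne with m ℕ.≡ᵇ n in eq
... | true = ⊥-elim (ne (ℕP.≡ᵇ⇒≡ m n (subst T (sym eq) tt)))
... | false = refl

Letter-∣∣≤ : ∀ {n z} → Letter n z → ∣ z ∣ ℕ.≤ n
Letter-∣∣≤ {n} {+ zero} ()
Letter-∣∣≤ {n} {+ suc k} p = p
Letter-∣∣≤ {n} { -[1+ k ] } p = p

Letter-notTop : ∀ {n z} → Letter n z → (suc n ℕ.≡ᵇ ∣ z ∣) ≡ false
Letter-notTop {n} {z} p = ≢⇒≡ᵇ≡false (suc n) ∣ z ∣ (λ e → ℕP.<-irrefl (sym e) (ℕ.s≤s (Letter-∣∣≤ p)))

∑ins-zero : ∀ c w → ∑ins (λ _ _ → + 0) c w ≡ + 0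
∑ins-zero c [] = refl
∑ins-zero c (y ∷ w) = trans (ℤP.+-identityˡ _) (∑ins-zero c w)

∑ins-absent : ∀ (F : ℤ → List ℤ → ℤ) c v k → ¬ k ≡ ∣ c ∣ →
  ∑ins (λ s σ → ifElse0 (not (elemᵇ k (map ∣_∣ σ))) (F s σ)) c v ≡ ifElse0 (not (elemᵇ k (map ∣_∣ v))) (∑ins F c v)
∑ins-absent F c [] k ne rewrite ≢⇒≡ᵇ≡false k ∣ c ∣ ne = refl
∑ins-absent F c (y ∷ v) k ne rewrite ≢⇒≡ᵇ≡false k ∣ c ∣ ne with k ℕ.≡ᵇ ∣ y ∣
... | true = trans (ℤP.+-identityˡ _) (∑ins-zero c v)
... | false = trans (cong (λ t → ifElse0 (not (elemᵇ k (map ∣_∣ v))) (F (-1^ (suc (length v))) (c ∷ y ∷ v)) + t) (∑ins-absent (λ s σ → F s (y ∷ σ)) c v k ne))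
                    (sym (ifElse0-+ (not (elemᵇ k (map ∣_∣ v))) _ _))

ifElse0-∧-shift : ∀ a b c v → ifElse0 ((a ∧ b) ∧ c) v ≡ ifElse0 (b ∧ c) (ifElse0 a v)
ifElse0-∧-shift true b c v = refl
ifElse0-∧-shift false true true v = refl
ifElse0-∧-shift false true false v = refl
ifElse0-∧-shift false false c v = refl

ifElse0-∧-true : ∀ a b v → ifElse0 ((a ∧ b) ∧ true) v ≡ ifElse0 a (ifElse0 b v)
ifElse0-∧-true true true v = refl
ifElse0-∧-true true false v = refl
ifElse0-∧-true false b v = refl

ifElse0-ifElse0 : ∀ a b v → ifElse0 b (ifElse0 a v) ≡ ifElse0 (a ∧ b) v
ifElse0-ifElse0 true b v = refl
ifElse0-ifElse0 false true v = refl
ifElse0-ifElse0 false false v = refl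

-- A word over ±[n+1] with distinct absolute values either avoids ±(n+1) or arises, uniquely,
-- by inserting n+1 or -(n+1) into such a word over ±[n].
module Top (n : ℕ) where
  L = letters n
  L' = letters (suc n)
  N = -[1+ n ]
  P = + suc n
  ∑insTop : (List ℤ → ℤ) → List ℤ → ℤ
  ∑insTop f v = ∑ins (λ _ σ → f σ) N v + ∑ins (λ _ σ → f σ) P v

  top≡ᵇtop : (suc n ℕ.≡ᵇ suc n) ≡ true
  top≡ᵇtop = T⇒≡true (ℕP.≡⇒≡ᵇ n n refl)

  ∑insTop-∷ : ∀ (f : List ℤ → ℤ) x v → ∑insTop f (x ∷ v) ≡ ∑insTop (λ σ → f (x ∷ σ)) v + (f (N ∷ x ∷ v) + f (P ∷ x ∷ v))
  ∑insTop-∷ f x v = lemma (f (N ∷ x ∷ v)) (f (P ∷ x ∷ v)) (∑ins (λ _ σ → f (x ∷ σ)) N v) (∑ins (λ _ σ → f (x ∷ σ)) P v)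
    where lemma : ∀ a b c d → a + c + (b + d) ≡ c + d + (a + b)
          lemma = solve-∀

  ∑insTop-fresh : ∀ (f : List ℤ → ℤ) {x} → Letter n x → ∀ v →
    ifElse0 (distinctAbs v) (∑insTop (λ u → ifElse0 (not (elemᵇ ∣ x ∣ (map ∣_∣ u))) (f (x ∷ u))) v)
    ≡ ifElse0 (distinctAbs (x ∷ v)) (∑insTop (λ σ → f (x ∷ σ)) v)
  ∑insTop-fresh f {x} sx v =
    trans (cong (ifElse0 (distinctAbs v))
            (trans (cong₂ _+_ (∑ins-absent (λ _ σ → f (x ∷ σ)) N v ∣ x ∣ (x≢top N refl)) (∑ins-absent (λ _ σ → f (x ∷ σ)) P v ∣ x ∣ (x≢top P refl)))
                   (sym (ifElse0-+ (not (elemᵇ ∣ x ∣ (map ∣_∣ v))) _ _))))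
          (ifElse0-ifElse0 (not (elemᵇ ∣ x ∣ (map ∣_∣ v))) (distinctAbs v) _)
    where x≢top : ∀ t → ∣ t ∣ ≡ suc n → ¬ ∣ x ∣ ≡ ∣ t ∣
          x≢top t e q = ℕP.<-irrefl (trans q e) (ℕ.s≤s (Letter-∣∣≤ sx))

  ∑-noTop : ∀ k (g : List ℤ → ℤ) → ∑ (λ u → ifElse0 (not (hasTop n u)) (g u)) (lists k L') ≡ ∑ g (lists k L)
  ∑-noTop zero g = refl
  ∑-noTop (suc k) g = begin
      ∑ (λ u → ifElse0 (not (hasTop n u)) (g u)) (lists (suc k) L') ≡⟨ ∑-lists-suc k L' (λ u → ifElse0 (not (hasTop n u)) (g u)) ⟩
      ∑ Φ L' ≡⟨ ∑-letters-suc n Φ ⟩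
      ∑ Φ L + (Φ N + Φ P) ≡⟨ cong₂ _+_ (∑-cong-All L (letters-Letter n) letter-case) (cong₂ _+_ (top-case N refl) (top-case P refl)) ⟩
      ∑ (λ x → ∑ (λ u → g (x ∷ u)) (lists k L)) L + (+ 0 + + 0) ≡⟨ ℤP.+-identityʳ _ ⟩
      ∑ (λ x → ∑ (λ u → g (x ∷ u)) (lists k L)) L ≡⟨ sym (∑-lists-suc k L g) ⟩
      ∑ g (lists (suc k) L) ∎
    where
    open ≡-Reasoning
    Φ : ℤ → ℤ
    Φ x = ∑ (λ u → ifElse0 (not (hasTop n (x ∷ u))) (g (x ∷ u))) (lists k L')
    letter-case : ∀ x → Letter n x → Φ x ≡ ∑ (λ u → g (x ∷ u)) (lists k L)
    letter-case x sx = trans (∑-cong (λ u → cong (λ b → ifElse0 (not (b ∨ hasTop n u)) (g (x ∷ u))) (Letter-notTop sx)) (lists k L')) (∑-noTop k (λ u → g (x ∷ u)))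
    top-case : ∀ t → ∣ t ∣ ≡ suc n → Φ t ≡ + 0
    top-case t e = trans (∑-cong (λ u → cong (λ b → ifElse0 (not (b ∨ hasTop n u)) (g (t ∷ u))) (trans (cong (suc n ℕ.≡ᵇ_) e) top≡ᵇtop)) (lists k L')) (∑-zero (lists k L'))

  ∑-hasTop : ∀ k (f : List ℤ → ℤ) → ∑ (λ u → ifElse0 (distinctAbs u ∧ hasTop n u) (f u)) (lists (suc k) L') ≡ ∑ (λ v → ifElse0 (distinctAbs v) (∑insTop f v)) (lists k L)
  ∑-hasTop zero f = begin
      ∑ (λ u → ifElse0 (distinctAbs u ∧ hasTop n u) (f u)) (lists 1 L') ≡⟨ ∑-lists-suc 0 L' (λ u → ifElse0 (distinctAbs u ∧ hasTop n u) (f u)) ⟩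
      ∑ Φ L' ≡⟨ ∑-letters-suc n Φ ⟩
      ∑ Φ L + (Φ N + Φ P) ≡⟨ cong₂ _+_ (trans (∑-cong-All L (letters-Letter n) letter-case) (∑-zero L)) (cong₂ _+_ (top-case N refl) (top-case P refl)) ⟩
      + 0 + ((f (N ∷ []) + + 0) + (f (P ∷ []) + + 0)) ≡⟨ l (f (N ∷ [])) (f (P ∷ [])) ⟩
      ∑ (λ v → ifElse0 (distinctAbs v) (∑insTop f v)) (lists 0 L) ∎
    where
    open ≡-Reasoning
    Φ : ℤ → ℤ
    Φ x = ∑ (λ u → ifElse0 (distinctAbs (x ∷ u) ∧ hasTop n (x ∷ u)) (f (x ∷ u))) (lists 0 L')
    letter-case : ∀ x → Letter n x → Φ x ≡ + 0
    letter-case x sx rewrite Letter-notTop sx = refl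
    top-case : ∀ t → ∣ t ∣ ≡ suc n → Φ t ≡ f (t ∷ []) + + 0
    top-case t e rewrite e | top≡ᵇtop = refl
    l : ∀ a b → + 0 + ((a + + 0) + (b + + 0)) ≡ (a + b) + + 0
    l = solve-∀
  ∑-hasTop (suc k) f = begin
      ∑ (λ u → ifElse0 (distinctAbs u ∧ hasTop n u) (f u)) (lists (suc (suc k)) L') ≡⟨ ∑-lists-suc (suc k) L' (λ u → ifElse0 (distinctAbs u ∧ hasTop n u) (f u)) ⟩
      ∑ Φ L' ≡⟨ ∑-letters-suc n Φ ⟩
      ∑ Φ L + (Φ N + Φ P) ≡⟨ cong₂ _+_ (∑-cong-All L (letters-Letter n) letter-case) (cong₂ _+_ (top-case N refl) (top-case P refl)) ⟩
      ∑ A L + (∑ (λ w → ifElse0 (distinctAbs w) (f (N ∷ w))) (lists (suc k) L) + ∑ (λ w → ifElse0 (distinctAbs w) (f (P ∷ w))) (lists (suc k) L))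
        ≡⟨ cong (λ t → ∑ A L + t) (cong₂ _+_ (∑-lists-suc k L (λ w → ifElse0 (distinctAbs w) (f (N ∷ w)))) (∑-lists-suc k L (λ w → ifElse0 (distinctAbs w) (f (P ∷ w))))) ⟩
      ∑ A L + (∑ BN L + ∑ BP L) ≡⟨ cong (λ t → ∑ A L + t) (sym (∑-+ BN BP L)) ⟩
      ∑ A L + ∑ (λ x → BN x + BP x) L ≡⟨ sym (∑-+ A (λ x → BN x + BP x) L) ⟩
      ∑ (λ x → A x + (BN x + BP x)) L ≡⟨ ∑-cong regroup L ⟩
      ∑ (λ x → ∑ (λ v → ifElse0 (distinctAbs (x ∷ v)) (∑insTop f (x ∷ v))) (lists k L)) L ≡⟨ sym (∑-lists-suc k L (λ v → ifElse0 (distinctAbs v) (∑insTop f v))) ⟩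
      ∑ (λ v → ifElse0 (distinctAbs v) (∑insTop f v)) (lists (suc k) L) ∎
    where
    open ≡-Reasoning
    Φ : ℤ → ℤ
    Φ x = ∑ (λ u → ifElse0 (distinctAbs (x ∷ u) ∧ hasTop n (x ∷ u)) (f (x ∷ u))) (lists (suc k) L')
    A : ℤ → ℤ
    A x = ∑ (λ v → ifElse0 (distinctAbs (x ∷ v)) (∑insTop (λ σ → f (x ∷ σ)) v)) (lists k L)
    BN : ℤ → ℤ
    BN x = ∑ (λ v → ifElse0 (distinctAbs (x ∷ v)) (f (N ∷ x ∷ v))) (lists k L)
    BP : ℤ → ℤ
    BP x = ∑ (λ v → ifElse0 (distinctAbs (x ∷ v)) (f (P ∷ x ∷ v))) (lists k L)
    letter-case : ∀ x → Letter n x → Φ x ≡ A x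
    letter-case x sx = begin
        Φ x ≡⟨ ∑-cong (λ u → trans (cong (λ b → ifElse0 ((not (elemᵇ ∣ x ∣ (map ∣_∣ u)) ∧ distinctAbs u) ∧ (b ∨ hasTop n u)) (f (x ∷ u))) (Letter-notTop sx))
                                    (ifElse0-∧-shift (not (elemᵇ ∣ x ∣ (map ∣_∣ u))) (distinctAbs u) (hasTop n u) (f (x ∷ u)))) (lists (suc k) L') ⟩
        ∑ (λ u → ifElse0 (distinctAbs u ∧ hasTop n u) (ifElse0 (not (elemᵇ ∣ x ∣ (map ∣_∣ u))) (f (x ∷ u)))) (lists (suc k) L') ≡⟨ ∑-hasTop k _ ⟩
        ∑ (λ v → ifElse0 (distinctAbs v) (∑insTop (λ u → ifElse0 (not (elemᵇ ∣ x ∣ (map ∣_∣ u))) (f (x ∷ u))) v)) (lists k L)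
          ≡⟨ ∑-cong (∑insTop-fresh f sx) (lists k L) ⟩
        A x ∎
    top-case : ∀ t → ∣ t ∣ ≡ suc n → Φ t ≡ ∑ (λ w → ifElse0 (distinctAbs w) (f (t ∷ w))) (lists (suc k) L)
    top-case t e = trans (∑-cong (λ u → trans (cong₂ (λ p b → ifElse0 ((not (elemᵇ p (map ∣_∣ u)) ∧ distinctAbs u) ∧ (b ∨ hasTop n u)) (f (t ∷ u))) e (trans (cong (suc n ℕ.≡ᵇ_) e) top≡ᵇtop))
                                  (trans (ifElse0-∧-true (not (elemᵇ (suc n) (map ∣_∣ u))) (distinctAbs u) (f (t ∷ u)))
                                         (cong (λ b → ifElse0 (not b) (ifElse0 (distinctAbs u) (f (t ∷ u)))) (elemᵇ-hasTop n u)))) (lists (suc k) L'))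
                   (∑-noTop (suc k) (λ u → ifElse0 (distinctAbs u) (f (t ∷ u))))
    regroup : ∀ x → A x + (BN x + BP x) ≡ ∑ (λ v → ifElse0 (distinctAbs (x ∷ v)) (∑insTop f (x ∷ v))) (lists k L)
    regroup x = trans (cong (λ t → A x + t) (sym (∑-+ _ _ (lists k L)))) (trans (sym (∑-+ _ _ (lists k L))) (∑-cong pointwise (lists k L)))
      where
      pointwise : ∀ v → ifElse0 (distinctAbs (x ∷ v)) (∑insTop (λ σ → f (x ∷ σ)) v) + (ifElse0 (distinctAbs (x ∷ v)) (f (N ∷ x ∷ v)) + ifElse0 (distinctAbs (x ∷ v)) (f (P ∷ x ∷ v)))
                 ≡ ifElse0 (distinctAbs (x ∷ v)) (∑insTop f (x ∷ v))
      pointwise v = trans (cong (λ t → ifElse0 (distinctAbs (x ∷ v)) (∑insTop (λ σ → f (x ∷ σ)) v) + t) (sym (ifElse0-+ (distinctAbs (x ∷ v)) _ _)))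
               (trans (sym (ifElse0-+ (distinctAbs (x ∷ v)) _ _)) (cong (ifElse0 (distinctAbs (x ∷ v))) (sym (∑insTop-∷ f x v))))

  ∑-split : ∀ k (f : List ℤ → ℤ) → ∑ (λ u → ifElse0 (distinctAbs u) (f u)) (lists (suc k) L')
            ≡ ∑ (λ v → ifElse0 (distinctAbs v) (∑insTop f v)) (lists k L) + ∑ (λ u → ifElse0 (distinctAbs u) (f u)) (lists (suc k) L)
  ∑-split k f = begin
    ∑ (λ u → ifElse0 (distinctAbs u) (f u)) (lists (suc k) L')
      ≡⟨ ∑-cong (λ u → ifElse0-split (distinctAbs u) (hasTop n u) (f u)) (lists (suc k) L') ⟩
    ∑ (λ u → ifElse0 (distinctAbs u ∧ hasTop n u) (f u) + ifElse0 (distinctAbs u ∧ not (hasTop n u)) (f u)) (lists (suc k) L')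
      ≡⟨ ∑-+ (λ u → ifElse0 (distinctAbs u ∧ hasTop n u) (f u)) (λ u → ifElse0 (distinctAbs u ∧ not (hasTop n u)) (f u)) (lists (suc k) L') ⟩
    ∑ (λ u → ifElse0 (distinctAbs u ∧ hasTop n u) (f u)) (lists (suc k) L') + ∑ (λ u → ifElse0 (distinctAbs u ∧ not (hasTop n u)) (f u)) (lists (suc k) L')
      ≡⟨ cong₂ _+_ (∑-hasTop k f)
           (trans (∑-cong (λ u → sym (ifElse0-ifElse0 (distinctAbs u) (not (hasTop n u)) (f u))) (lists (suc k) L'))
                  (∑-noTop (suc k) (λ u → ifElse0 (distinctAbs u) (f u)))) ⟩
    ∑ (λ v → ifElse0 (distinctAbs v) (∑insTop f v)) (lists k L) + ∑ (λ u → ifElse0 (distinctAbs u) (f u)) (lists (suc k) L) ∎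
    where open ≡-Reasoning

∑-distinct-tooLong : ∀ n k (f : List ℤ → ℤ) → n ℕ.< k → ∑ (λ u → ifElse0 (distinctAbs u) (f u)) (lists k (letters n)) ≡ + 0
∑-distinct-tooLong zero (suc k) f _ = refl
∑-distinct-tooLong (suc n) (suc k) f (ℕ.s≤s n<k) =
  trans (Top.∑-split n k f)
        (cong₂ _+_ (∑-distinct-tooLong n k (Top.∑insTop n f) n<k) (∑-distinct-tooLong n (suc k) f (ℕP.m<n⇒m<1+n n<k)))

∑-Bn : ∀ n (g : List ℤ → ℤ) → ∑ g (Bn n) ≡ ∑ (λ v → ifElse0 (distinctAbs v) (g v)) (lists n (letters n))
∑-Bn n g = trans (∑-filter (λ σ → unique? (map ∣_∣ σ)) g (lists n (letters n))) (∑-cong (λ u → cong (λ b → ifElse0 b (g u)) (unique?≡uniqueᵇ (map ∣_∣ u))) (lists n (letters n)))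

∑-Bn-suc : ∀ n (f : List ℤ → ℤ) → ∑ f (Bn (suc n)) ≡ ∑ (λ v → ifElse0 (distinctAbs v) (Top.∑insTop n f v)) (lists n (letters n))
∑-Bn-suc n f = begin
  ∑ f (Bn (suc n))                                                                        ≡⟨ ∑-Bn (suc n) f ⟩
  ∑ (λ u → ifElse0 (distinctAbs u) (f u)) (lists (suc n) (letters (suc n)))               ≡⟨ Top.∑-split n n f ⟩
  ∑ (λ v → ifElse0 (distinctAbs v) (Top.∑insTop n f v)) (lists n (letters n))
    + ∑ (λ u → ifElse0 (distinctAbs u) (f u)) (lists (suc n) (letters n))                 ≡⟨ cong (λ t → ∑ (λ v → ifElse0 (distinctAbs v) (Top.∑insTop n f v)) (lists n (letters n)) + t) (∑-distinct-tooLong n (suc n) f ℕP.≤-refl) ⟩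
  ∑ (λ v → ifElse0 (distinctAbs v) (Top.∑insTop n f v)) (lists n (letters n)) + + 0     ≡⟨ ℤP.+-identityʳ _ ⟩
  ∑ (λ v → ifElse0 (distinctAbs v) (Top.∑insTop n f v)) (lists n (letters n))             ∎
  where open ≡-Reasoning

countBelow : ℕ → List ℕ → ℕ
countBelow x xs = length (filter (λ y → y ℕ.<? x) xs)

countBelow-skip : ∀ x l1 k l2 → ¬ k ℕ.< x → countBelow x (l1 ++ k ∷ l2) ≡ countBelow x (l1 ++ l2)
countBelow-skip x [] k l2 nk with k ℕ.<ᵇ x in eq
... | true = ⊥-elim (nk (ℕP.<ᵇ⇒< k x (subst T (sym eq) _)))
... | false = refl
countBelow-skip x (z ∷ l1) k l2 nk with z ℕ.<ᵇ x
... | true = cong suc (countBelow-skip x l1 k l2 nk)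
... | false = countBelow-skip x l1 k l2 nk

countBelow-all : ∀ k l → All (ℕ._< k) l → countBelow k l ≡ length l
countBelow-all k [] [] = refl
countBelow-all k (z ∷ l) (p ∷ ps) with z ℕ.<ᵇ k in z<ᵇk
... | true = cong suc (countBelow-all k l ps)
... | false with trans (sym z<ᵇk) (T⇒≡true (ℕP.<⇒<ᵇ p))
...   | ()

inv-insert-max : ∀ l1 k l2 → All (ℕ._< k) (l1 ++ l2) → inv (l1 ++ k ∷ l2) ≡ inv (l1 ++ l2) ℕ.+ length l2
inv-insert-max [] k l2 al = trans (cong (ℕ._+ inv l2) (countBelow-all k l2 al)) (ℕP.+-comm (length l2) (inv l2))
inv-insert-max (y ∷ l1) k l2 (py ∷ al) = trans (cong₂ ℕ._+_ (countBelow-skip y l1 k l2 (λ q → ℕP.<-asym q py)) (inv-insert-max l1 k l2 al))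
                                       (sym (ℕP.+-assoc (countBelow y (l1 ++ l2)) (inv (l1 ++ l2)) (length l2)))

absSign : List ℤ → ℤ
absSign σ = -1^ (inv (map ∣_∣ σ))

absSign-insert-max : ∀ pre c r → All (λ z → ∣ z ∣ ℕ.< ∣ c ∣) (pre ++ r) → absSign (pre ++ c ∷ r) ≡ absSign (pre ++ r) * -1^ (length r)
absSign-insert-max pre c r al = begin
    -1^ (inv (map ∣_∣ (pre ++ c ∷ r))) ≡⟨ cong (λ l → -1^ (inv l)) (LP.map-++ ∣_∣ pre (c ∷ r)) ⟩
    -1^ (inv (map ∣_∣ pre ++ ∣ c ∣ ∷ map ∣_∣ r)) ≡⟨ cong -1^_ (inv-insert-max (map ∣_∣ pre) ∣ c ∣ (map ∣_∣ r) al') ⟩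
    -1^ (inv (map ∣_∣ pre ++ map ∣_∣ r) ℕ.+ length (map ∣_∣ r)) ≡⟨ -1^-+ (inv (map ∣_∣ pre ++ map ∣_∣ r)) (length (map ∣_∣ r)) ⟩
    -1^ (inv (map ∣_∣ pre ++ map ∣_∣ r)) * -1^ (length (map ∣_∣ r)) ≡⟨ cong₂ (λ l k → -1^ (inv l) * -1^ k) (sym (LP.map-++ ∣_∣ pre r)) (LP.length-map ∣_∣ r) ⟩
    absSign (pre ++ r) * -1^ (length r) ∎
  where
  open ≡-Reasoning
  al' : All (ℕ._< ∣ c ∣) (map ∣_∣ pre ++ map ∣_∣ r)
  al' = subst (All (ℕ._< ∣ c ∣)) (LP.map-++ ∣_∣ pre r) (AllP.map⁺ al)

∑ins-absSign : ∀ (G : List ℤ → ℤ) c pre w → All (λ z → ∣ z ∣ ℕ.< ∣ c ∣) (pre ++ w) →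
  ∑ins (λ _ u → absSign (pre ++ u) * G u) c w ≡ absSign (pre ++ w) * ∑ins (λ s u → s * G u) c w
∑ins-absSign G c pre [] al = trans (cong (_* G (c ∷ [])) (absSign-insert-max pre c [] al)) (l (absSign (pre ++ [])) (G (c ∷ [])))
  where l : ∀ e g → e * + 1 * g ≡ e * (+ 1 * g)
        l = solve-∀
∑ins-absSign G c pre (y ∷ w) al = begin
    absSign (pre ++ c ∷ y ∷ w) * G (c ∷ y ∷ w) + ∑ins (λ _ u → absSign (pre ++ y ∷ u) * G (y ∷ u)) c w
      ≡⟨ cong₂ _+_ (cong (_* G (c ∷ y ∷ w)) (absSign-insert-max pre c (y ∷ w) al))
                   (trans (∑ins-cong c w (λ s u → cong (λ l → absSign l * G (y ∷ u)) (sym (LP.++-assoc pre (y ∷ []) u))))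
                          (∑ins-absSign (λ u → G (y ∷ u)) c (pre ++ y ∷ []) w (subst (All _) (sym (LP.++-assoc pre (y ∷ []) w)) al))) ⟩
    absSign (pre ++ y ∷ w) * -1^ (suc (length w)) * G (c ∷ y ∷ w) + absSign ((pre ++ y ∷ []) ++ w) * ∑ins (λ s u → s * G (y ∷ u)) c w
      ≡⟨ cong (λ l → absSign (pre ++ y ∷ w) * -1^ (suc (length w)) * G (c ∷ y ∷ w) + absSign l * ∑ins (λ s u → s * G (y ∷ u)) c w) (LP.++-assoc pre (y ∷ []) w) ⟩
    absSign (pre ++ y ∷ w) * -1^ (suc (length w)) * G (c ∷ y ∷ w) + absSign (pre ++ y ∷ w) * ∑ins (λ s u → s * G (y ∷ u)) c w
      ≡⟨ l (absSign (pre ++ y ∷ w)) (-1^ (suc (length w))) (G (c ∷ y ∷ w)) (∑ins (λ s u → s * G (y ∷ u)) c w) ⟩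
    absSign (pre ++ y ∷ w) * (-1^ (suc (length w)) * G (c ∷ y ∷ w) + ∑ins (λ s u → s * G (y ∷ u)) c w) ∎
  where
  open ≡-Reasoning
  l : ∀ e p g s → e * p * g + e * s ≡ e * (p * g + s)
  l = solve-∀

negLetter : ℤ → ℕ
negLetter z = neg (z ∷ [])

neg-∷ : ∀ z l → neg (z ∷ l) ≡ negLetter z ℕ.+ neg l
neg-∷ (+ _) l = refl
neg-∷ -[1+ _ ] l = refl

∑ins-negPow : ∀ q (F : ℤ → List ℤ → ℤ) c w → ∑ins (λ s u → F s u * q ^ᶻ neg u) c w ≡ q ^ᶻ (negLetter c ℕ.+ neg w) * ∑ins F c w
∑ins-negPow q F c [] = trans (cong (λ k → F (+ 1) (c ∷ []) * q ^ᶻ k) (neg-∷ c [])) (ℤP.*-comm (F (+ 1) (c ∷ [])) (q ^ᶻ (negLetter c ℕ.+ neg [])))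
∑ins-negPow q F c (y ∷ w) = begin
    F p (c ∷ y ∷ w) * q ^ᶻ neg (c ∷ y ∷ w) + ∑ins (λ s u → F s (y ∷ u) * q ^ᶻ neg (y ∷ u)) c w
      ≡⟨ cong₂ _+_ (cong (λ k → F p (c ∷ y ∷ w) * q ^ᶻ k) (trans (neg-∷ c (y ∷ w)) (cong (negLetter c ℕ.+_) (neg-∷ y w))))
                   (trans (∑ins-cong c w (λ s u → trans (cong (λ k → F s (y ∷ u) * q ^ᶻ k) (neg-∷ y u))
                                                   (trans (cong (F s (y ∷ u) *_) (^ᶻ-+ q (negLetter y) (neg u))) (l1 (F s (y ∷ u)) (q ^ᶻ negLetter y) (q ^ᶻ neg u)))))
                          (trans (∑ins-negPow q (λ s u → q ^ᶻ negLetter y * F s (y ∷ u)) c w)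
                                 (cong (q ^ᶻ (negLetter c ℕ.+ neg w) *_) (∑ins-scale (q ^ᶻ negLetter y) (λ s u → F s (y ∷ u)) c w)))) ⟩
    F p (c ∷ y ∷ w) * q ^ᶻ (negLetter c ℕ.+ (negLetter y ℕ.+ neg w)) + q ^ᶻ (negLetter c ℕ.+ neg w) * (q ^ᶻ negLetter y * ∑ins (λ s u → F s (y ∷ u)) c w)
      ≡⟨ cong₂ (λ a b → F p (c ∷ y ∷ w) * a + b * (q ^ᶻ negLetter y * ∑ins (λ s u → F s (y ∷ u)) c w))
           (trans (^ᶻ-+ q (negLetter c) (negLetter y ℕ.+ neg w)) (cong (q ^ᶻ negLetter c *_) (^ᶻ-+ q (negLetter y) (neg w)))) (^ᶻ-+ q (negLetter c) (neg w)) ⟩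
    F p (c ∷ y ∷ w) * (q ^ᶻ negLetter c * (q ^ᶻ negLetter y * q ^ᶻ neg w)) + q ^ᶻ negLetter c * q ^ᶻ neg w * (q ^ᶻ negLetter y * ∑ins (λ s u → F s (y ∷ u)) c w)
      ≡⟨ l2 (F p (c ∷ y ∷ w)) (q ^ᶻ negLetter c) (q ^ᶻ negLetter y) (q ^ᶻ neg w) (∑ins (λ s u → F s (y ∷ u)) c w) ⟩
    q ^ᶻ negLetter c * (q ^ᶻ negLetter y * q ^ᶻ neg w) * (F p (c ∷ y ∷ w) + ∑ins (λ s u → F s (y ∷ u)) c w)
      ≡⟨ cong (λ a → a * (F p (c ∷ y ∷ w) + ∑ins (λ s u → F s (y ∷ u)) c w))
           (sym (trans (^ᶻ-+ q (negLetter c) (negLetter y ℕ.+ neg w)) (cong (q ^ᶻ negLetter c *_) (^ᶻ-+ q (negLetter y) (neg w))))) ⟩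
    q ^ᶻ (negLetter c ℕ.+ (negLetter y ℕ.+ neg w)) * (F p (c ∷ y ∷ w) + ∑ins (λ s u → F s (y ∷ u)) c w)
      ≡⟨ cong (λ k → q ^ᶻ (negLetter c ℕ.+ k) * (F p (c ∷ y ∷ w) + ∑ins (λ s u → F s (y ∷ u)) c w)) (sym (neg-∷ y w)) ⟩
    q ^ᶻ (negLetter c ℕ.+ neg (y ∷ w)) * (F p (c ∷ y ∷ w) + ∑ins (λ s u → F s (y ∷ u)) c w) ∎
  where
  open ≡-Reasoning
  p = -1^ (suc (length w))
  l1 : ∀ f a b → f * (a * b) ≡ a * f * b
  l1 = solve-∀
  l2 : ∀ f a b c S → f * (a * (b * c)) + a * c * (b * S) ≡ a * (b * c) * (f + S)
  l2 = solve-∀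

^ᶻ-fmaj : ∀ q σ → q ^ᶻ fmaj σ ≡ (q * q) ^ᶻ maj σ * q ^ᶻ neg σ
^ᶻ-fmaj q σ = trans (^ᶻ-+ q (2 ℕ.* maj σ) (neg σ)) (cong (_* q ^ᶻ neg σ) (^ᶻ-double q (maj σ)))

lists-length : ∀ k (L : List ℤ) → All (λ u → length u ≡ k) (lists k L)
lists-length zero L = refl ∷ []
lists-length (suc k) L = AllP.concat⁺ (AllP.map⁺ (All.universal (λ x → AllP.map⁺ (All.map (cong suc) (lists-length k L))) L))

lists-letters : ∀ n → All (λ u → All (Letter n) u × length u ≡ n) (lists n (letters n))
lists-letters n = All.zip (lists-All n (letters n) (letters-Letter n) , lists-length n (letters n))

ifElse0-scale : ∀ b k v → ifElse0 b (k * v) ≡ k * ifElse0 b v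
ifElse0-scale true k v = refl
ifElse0-scale false k v = sym (ℤP.*-zeroʳ k)

∑-Bn-suc-factor : ∀ n (f g : List ℤ → ℤ) (K : ℤ) → (∀ v → All (Letter n) v → length v ≡ n → Top.∑insTop n f v ≡ K * g v) →
  ∑ f (Bn (suc n)) ≡ K * ∑ g (Bn n)
∑-Bn-suc-factor n f g K pointwise = begin
    ∑ f (Bn (suc n)) ≡⟨ ∑-Bn-suc n f ⟩
    ∑ (λ v → ifElse0 (distinctAbs v) (Top.∑insTop n f v)) (lists n (letters n)) ≡⟨ ∑-cong-All (lists n (letters n)) (lists-letters n) (λ v (sv , lv) → trans (cong (ifElse0 (distinctAbs v)) (pointwise v sv lv)) (ifElse0-scale (distinctAbs v) K (g v))) ⟩
    ∑ (λ v → K * ifElse0 (distinctAbs v) (g v)) (lists n (letters n)) ≡⟨ ∑-scale K _ (lists n (letters n)) ⟩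
    K * ∑ (λ v → ifElse0 (distinctAbs v) (g v)) (lists n (letters n)) ≡⟨ cong (K *_) (sym (∑-Bn n g)) ⟩
    K * ∑ g (Bn n) ∎
  where open ≡-Reasoning

Letter-≢top : ∀ {n z} (c : ℤ) → ∣ c ∣ ≡ suc n → Letter n z → ¬ c ≡ z
Letter-≢top {n} {z} c e sz refl = ℕP.<-irrefl e (ℕ.s≤s (Letter-∣∣≤ sz))

Letter-∣∣<top : ∀ {n z} (c : ℤ) → ∣ c ∣ ≡ suc n → Letter n z → ∣ z ∣ ℕ.< ∣ c ∣
Letter-∣∣<top {n} {z} c e sz rewrite e = ℕ.s≤s (Letter-∣∣≤ sz)

fmajGF : ℤ → ℕ → ℤ
fmajGF q n = ∑ (λ σ → q ^ᶻ fmaj σ) (Bn n)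

∑ins-fmaj : ∀ q n c v → ∣ c ∣ ≡ suc n → All (Letter n) v →
  ∑ins (λ _ σ → q ^ᶻ fmaj σ) c v ≡ q ^ᶻ (negLetter c ℕ.+ neg v) * ((q * q) ^ᶻ maj v * qint (suc (length v)) (q * q))
∑ins-fmaj q n c v e sv = trans (∑ins-cong c v (λ s σ → ^ᶻ-fmaj q σ))
  (trans (∑ins-negPow q (λ _ σ → (q * q) ^ᶻ maj σ) c v)
    (cong (q ^ᶻ (negLetter c ℕ.+ neg v) *_) (∑insMaj-closed (q * q) c v (All.map (Letter-≢top c e) sv))))

fmajGF-suc : ∀ q n → fmajGF q (suc n) ≡ qint (2 ℕ.* suc n) q * fmajGF q n
fmajGF-suc q n = ∑-Bn-suc-factor n (λ σ → q ^ᶻ fmaj σ) (λ σ → q ^ᶻ fmaj σ) (qint (2 ℕ.* suc n) q) pointwise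
  where
  pointwise : ∀ v → All (Letter n) v → length v ≡ n → Top.∑insTop n (λ σ → q ^ᶻ fmaj σ) v ≡ qint (2 ℕ.* suc n) q * q ^ᶻ fmaj v
  pointwise v sv lv = begin
      Top.∑insTop n (λ σ → q ^ᶻ fmaj σ) v ≡⟨ cong₂ _+_ (∑ins-fmaj q n (-[1+ n ]) v refl sv) (∑ins-fmaj q n (+ suc n) v refl sv) ⟩
      q ^ᶻ suc (neg v) * ((q * q) ^ᶻ maj v * qint (suc (length v)) (q * q)) + q ^ᶻ (neg v) * ((q * q) ^ᶻ maj v * qint (suc (length v)) (q * q))
        ≡⟨ cong (λ l → q ^ᶻ suc (neg v) * ((q * q) ^ᶻ maj v * qint (suc l) (q * q)) + q ^ᶻ (neg v) * ((q * q) ^ᶻ maj v * qint (suc l) (q * q))) lv ⟩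
      q * q ^ᶻ neg v * ((q * q) ^ᶻ maj v * qint (suc n) (q * q)) + q ^ᶻ (neg v) * ((q * q) ^ᶻ maj v * qint (suc n) (q * q))
        ≡⟨ l q (q ^ᶻ neg v) ((q * q) ^ᶻ maj v) (qint (suc n) (q * q)) ⟩
      (+ 1 + q) * qint (suc n) (q * q) * ((q * q) ^ᶻ maj v * q ^ᶻ neg v) ≡⟨ cong₂ _*_ (sym (qint-double (suc n) q)) (sym (^ᶻ-fmaj q v)) ⟩
      qint (2 ℕ.* suc n) q * q ^ᶻ fmaj v ∎
    where
    open ≡-Reasoning
    l : ∀ q a m Q → q * a * (m * Q) + a * (m * Q) ≡ (+ 1 + q) * Q * (m * a)
    l = solve-∀

fmajGF-closed : ∀ q n → fmajGF q n ≡ prodQ n (λ _ → q)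
fmajGF-closed q zero = refl
fmajGF-closed q (suc n) = trans (fmajGF-suc q n) (trans (cong (qint (2 ℕ.* suc n) q *_) (fmajGF-closed q n)) (ℤP.*-comm (qint (2 ℕ.* suc n) q) (prodQ n (λ _ → q))))

q*q≡+ : ∀ q → q * q ≡ + (∣ q ∣ ℕ.* ∣ q ∣)
q*q≡+ (+ k) = sym (ℤP.pos-* k k)
q*q≡+ -[1+ k ] = refl

square-cancel : ∀ q d1 d2 R → (+ 1 + q * q) * d1 ≡ R → (+ 1 + q * q) * d2 ≡ R → q * q * d1 + d2 ≡ R
square-cancel q d1 d2 R e1 e2 = ℤP.*-cancelˡ-≡ (+ suc (∣ q ∣ ℕ.* ∣ q ∣)) (q * q * d1 + d2) R
  (subst (λ c → c * (q * q * d1 + d2) ≡ c * R) (cong (λ t → + 1 + t) (q*q≡+ q)) main)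
  where
  x = q * q
  main : (+ 1 + x) * (x * d1 + d2) ≡ (+ 1 + x) * R
  main = begin
      (+ 1 + x) * (x * d1 + d2) ≡⟨ l x d1 d2 ⟩
      x * ((+ 1 + x) * d1) + (+ 1 + x) * d2 ≡⟨ cong₂ (λ a b → x * a + b) e1 e2 ⟩
      x * R + R ≡⟨ l2 x R ⟩
      (+ 1 + x) * R ∎
    where
    open ≡-Reasoning
    l : ∀ x d1 d2 → (+ 1 + x) * (x * d1 + d2) ≡ x * ((+ 1 + x) * d1) + (+ 1 + x) * d2
    l = solve-∀
    l2 : ∀ x R → x * R + R ≡ (+ 1 + x) * R
    l2 = solve-∀

absSignFmajGF : ℤ → ℕ → ℤ
absSignFmajGF q n = ∑ (λ σ → absSign σ * q ^ᶻ fmaj σ) (Bn n)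

module TwoLetters (q : ℤ) (n : ℕ) where
  x = q * q
  G : List ℤ → ℤ
  G σ = x ^ᶻ maj σ
  f : List ℤ → ℤ
  f σ = absSign σ * q ^ᶻ fmaj σ
  S : ℤ → List ℤ → ℤ
  S b τ = ∑ins (λ s σ → s * G σ) b τ
  N0 = -[1+ n ]
  P0 = + suc n
  N1 = -[1+ suc n ]
  P1 = + suc (suc n)
  H : List ℤ → ℤ
  H = Top.∑insTop (suc n) f
  K = qint (suc n) x * (+ 1 - x ^ᶻ suc (suc n))

  ∑ins-f : ∀ m b τ → ∣ b ∣ ≡ suc m → All (Letter m) τ → ∑ins (λ _ σ → f σ) b τ ≡ absSign τ * (q ^ᶻ (negLetter b ℕ.+ neg τ) * S b τ)
  ∑ins-f m b τ e sτ = trans (∑ins-cong b τ (λ _ σ → cong (absSign σ *_) (^ᶻ-fmaj q σ)))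
    (trans (∑ins-absSign (λ σ → G σ * q ^ᶻ neg σ) b [] τ (All.map (Letter-∣∣<top b e) sτ))
      (cong (absSign τ *_) (trans (∑ins-cong b τ (λ s σ → sym (ℤP.*-assoc s (G σ) (q ^ᶻ neg σ)))) (∑ins-negPow q (λ s σ → s * G σ) b τ))))

  Y : List ℤ → ℤ
  Y τ = q ^ᶻ neg τ * (q * S N1 τ + S P1 τ)

  ∑insTop-f : ∀ τ → All (Letter (suc n)) τ → H τ ≡ absSign τ * Y τ
  ∑insTop-f τ sτ = trans (cong₂ _+_ (∑ins-f (suc n) N1 τ refl sτ) (∑ins-f (suc n) P1 τ refl sτ))
                     (l (absSign τ) q (q ^ᶻ neg τ) (S N1 τ) (S P1 τ))
    where l : ∀ e q a s1 s2 → e * (q * a * s1) + e * (a * s2) ≡ e * (a * (q * s1 + s2))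
          l = solve-∀

  sign*S : ∀ s b τ → s * S b τ ≡ ∑ins (λ s2 σ → s * s2 * G σ) b τ
  sign*S s b τ = trans (sym (∑ins-scale s (λ s2 σ → s2 * G σ) b τ)) (∑ins-cong b τ (λ s2 σ → sym (ℤP.*-assoc s s2 (G σ))))

  ∑ins-S-pair : ∀ a ρ → ∑ins (λ s τ → s * (q * S N1 τ + S P1 τ)) a ρ ≡ q * ∑ins² G a N1 ρ + ∑ins² G a P1 ρ
  ∑ins-S-pair a ρ = trans (∑ins-cong a ρ (λ s τ → trans (l s q (S N1 τ) (S P1 τ)) (cong₂ (λ u v → q * u + v) (sign*S s N1 τ) (sign*S s P1 τ))))
                 (trans (∑ins-+ _ _ a ρ) (cong (_+ ∑ins² G a P1 ρ) (∑ins-scale q (λ s τ → ∑ins (λ s2 σ → s * s2 * G σ) N1 τ) a ρ)))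
    where l : ∀ s q a b → s * (q * a + b) ≡ q * (s * a) + s * b
          l = solve-∀

  ∑ins-∑insTop-f : ∀ a ρ → ∣ a ∣ ≡ suc n → All (Letter n) ρ → ∑ins (λ _ τ → H τ) a ρ ≡ absSign ρ * (q ^ᶻ (negLetter a ℕ.+ neg ρ) * (q * ∑ins² G a N1 ρ + ∑ins² G a P1 ρ))
  ∑ins-∑insTop-f a ρ e sρ = begin
      ∑ins (λ _ τ → H τ) a ρ ≡⟨ ∑ins-cong-All {P = Letter (suc n)} a ρ (Letter-top a e) (All.map Letter-suc sρ) (λ s τ sτ → ∑insTop-f τ sτ) ⟩
      ∑ins (λ _ τ → absSign τ * Y τ) a ρ ≡⟨ ∑ins-absSign Y a [] ρ (All.map (Letter-∣∣<top a e) sρ) ⟩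
      absSign ρ * ∑ins (λ s τ → s * Y τ) a ρ ≡⟨ cong (absSign ρ *_) (trans (∑ins-cong a ρ (λ s τ → l s (q ^ᶻ neg τ) (q * S N1 τ + S P1 τ))) (∑ins-negPow q (λ s τ → s * (q * S N1 τ + S P1 τ)) a ρ)) ⟩
      absSign ρ * (q ^ᶻ (negLetter a ℕ.+ neg ρ) * ∑ins (λ s τ → s * (q * S N1 τ + S P1 τ)) a ρ) ≡⟨ cong (λ t → absSign ρ * (q ^ᶻ (negLetter a ℕ.+ neg ρ) * t)) (∑ins-S-pair a ρ) ⟩
      absSign ρ * (q ^ᶻ (negLetter a ℕ.+ neg ρ) * (q * ∑ins² G a N1 ρ + ∑ins² G a P1 ρ)) ∎
    where
    open ≡-Reasoning
    l : ∀ s a b → s * (a * b) ≡ s * b * a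
    l = solve-∀
    Letter-top : ∀ a → ∣ a ∣ ≡ suc n → Letter (suc n) a
    Letter-top (+ zero) ()
    Letter-top (+ suc k) e = ℕ.s≤s (ℕP.≤-reflexive (ℕP.suc-injective e))
    Letter-top -[1+ k ] e = ℕ.s≤s (ℕP.≤-reflexive (ℕP.suc-injective e))

  N0<N1 : ltB N0 N1 ≡ true
  N0<N1 = <⇒<ᵇ≡true (ℕP.n<1+n n)
  N1≢N0 : ¬ N1 ≡ N0
  N1≢N0 e = ℕP.1+n≢n (ℤP.-[1+-injective e)
  P0<P1 : ltB P0 P1 ≡ true
  P0<P1 = <⇒<ᵇ≡true (ℕP.n<1+n n)
  P1≢P0 : ¬ P1 ≡ P0
  P1≢P0 e = ℕP.1+n≢n (ℕP.suc-injective (ℤP.+-injective e))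

  ∑insTop²-f : ∀ ρ → All (Letter n) ρ → length ρ ≡ n → Top.∑insTop n H ρ ≡ K * f ρ
  ∑insTop²-f ρ sρ lρ = begin
      Top.∑insTop n H ρ ≡⟨ cong₂ _+_ (∑ins-∑insTop-f N0 ρ refl sρ) (∑ins-∑insTop-f P0 ρ refl sρ) ⟩
      absSign ρ * (q ^ᶻ suc (neg ρ) * (q * DNN + DNP)) + absSign ρ * (q ^ᶻ neg ρ * (q * DPN + DPP)) ≡⟨ l (absSign ρ) q (q ^ᶻ neg ρ) DNN DNP DPN DPP ⟩
      absSign ρ * q ^ᶻ neg ρ * ((q * q * DNN + DPP) + q * (DPN + DNP)) ≡⟨ cong₂ (λ a b → absSign ρ * q ^ᶻ neg ρ * (a + q * b)) (square-cancel q DNN DPP R bN bP) mix ⟩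
      absSign ρ * q ^ᶻ neg ρ * (R + q * + 0) ≡⟨ cong (λ l → absSign ρ * q ^ᶻ neg ρ * (x ^ᶻ maj ρ * qint (suc l) x * (+ 1 - x ^ᶻ suc (suc l)) + q * + 0)) lρ ⟩
      absSign ρ * q ^ᶻ neg ρ * (x ^ᶻ maj ρ * qint (suc n) x * (+ 1 - x ^ᶻ suc (suc n)) + q * + 0) ≡⟨ l2 (absSign ρ) (q ^ᶻ neg ρ) (x ^ᶻ maj ρ) (qint (suc n) x) (x ^ᶻ suc (suc n)) q ⟩
      K * (absSign ρ * (x ^ᶻ maj ρ * q ^ᶻ neg ρ)) ≡⟨ cong (λ t → K * (absSign ρ * t)) (sym (^ᶻ-fmaj q ρ)) ⟩
      K * f ρ ∎
    where
    open ≡-Reasoning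
    DNN = ∑ins² G N0 N1 ρ
    DNP = ∑ins² G N0 P1 ρ
    DPN = ∑ins² G P0 N1 ρ
    DPP = ∑ins² G P0 P1 ρ
    R = x ^ᶻ maj ρ * qint (suc (length ρ)) x * (+ 1 - x ^ᶻ suc (suc (length ρ)))
    bN : (+ 1 + x) * DNN ≡ R
    bN = Adjacent.∑ins²-adjacent x N0 N1 N0<N1 N1≢N0 ρ (All.map (λ {z} → sameSide⁻ n z) sρ)
    bP : (+ 1 + x) * DPP ≡ R
    bP = Adjacent.∑ins²-adjacent x P0 P1 P0<P1 P1≢P0 ρ (All.map (λ {z} → sameSide⁺ n z) sρ)
    mix : DPN + DNP ≡ + 0
    mix = Mixed.∑ins²-mixed-cancel n x ρ sρ
    l : ∀ e q a nn np pn pp → e * (q * a * (q * nn + np)) + e * (a * (q * pn + pp)) ≡ e * a * ((q * q * nn + pp) + q * (pn + np))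
    l = solve-∀
    l2 : ∀ e a m Q X q → e * a * (m * Q * (+ 1 - X) + q * + 0) ≡ Q * (+ 1 - X) * (e * (m * a))
    l2 = solve-∀

absSignFmajGF-suc² : ∀ q n → absSignFmajGF q (suc (suc n)) ≡ TwoLetters.K q n * absSignFmajGF q n
absSignFmajGF-suc² q n = begin
    ∑ f (Bn (suc (suc n))) ≡⟨ ∑-Bn-suc (suc n) f ⟩
    ∑ (λ v → ifElse0 (distinctAbs v) (H v)) (lists (suc n) (letters (suc n))) ≡⟨ sym (∑-Bn (suc n) H) ⟩
    ∑ H (Bn (suc n)) ≡⟨ ∑-Bn-suc-factor n H f (TwoLetters.K q n) (TwoLetters.∑insTop²-f q n) ⟩
    TwoLetters.K q n * ∑ f (Bn n) ∎
  where
  open ≡-Reasoning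
  f = TwoLetters.f q n
  H = TwoLetters.H q n

altSign⁻ : ℤ → ℕ → ℤ
altSign⁻ q i = - altSign i q

altSign⁻-square : ∀ q i → altSign⁻ q i * altSign⁻ q i ≡ q * q
altSign⁻-square q i with isEven i
... | true = l q
  where l : ∀ q → - q * - q ≡ q * q
        l = solve-∀
... | false = l q
  where l : ∀ q → - - q * - - q ≡ q * q
        l = solve-∀

altSign⁻-suc² : ∀ q n → altSign⁻ q (suc (suc n)) ≡ - altSign⁻ q (suc n)
altSign⁻-suc² q n rewrite isEven-suc n with isEven n
... | true = sym (ℤP.neg-involutive (- q))
... | false = refl

qint-consecutive : ∀ y x n → y * y ≡ x → qint (2 ℕ.* suc n) y * qint (2 ℕ.* suc (suc n)) (- y) ≡ qint (suc n) x * (+ 1 - x ^ᶻ suc (suc n))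
qint-consecutive y x n yy = begin
    qint (2 ℕ.* suc n) y * qint (2 ℕ.* suc (suc n)) (- y) ≡⟨ cong₂ _*_ (qint-double (suc n) y) (qint-double (suc (suc n)) (- y)) ⟩
    (+ 1 + y) * qint (suc n) (y * y) * ((+ 1 + - y) * qint (suc (suc n)) (- y * - y)) ≡⟨ cong₂ (λ a b → (+ 1 + y) * qint (suc n) a * ((+ 1 + - y) * qint (suc (suc n)) b)) yy (trans (l0 y) yy) ⟩
    (+ 1 + y) * Q1 * ((+ 1 + - y) * Q2) ≡⟨ l1 y Q1 Q2 ⟩
    Q1 * (Q2 - y * y * Q2) ≡⟨ cong (λ t → Q1 * (Q2 - t * Q2)) yy ⟩
    Q1 * (Q2 - x * Q2) ≡⟨ l2 x Q1 Q2 ⟩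
    Q1 * - ((x - + 1) * Q2) ≡⟨ cong (λ t → Q1 * - t) (qint-geometric (suc (suc n)) x) ⟩
    Q1 * - (x ^ᶻ suc (suc n) - + 1) ≡⟨ l3 Q1 (x ^ᶻ suc (suc n)) ⟩
    qint (suc n) x * (+ 1 - x ^ᶻ suc (suc n)) ∎
  where
  open ≡-Reasoning
  Q1 = qint (suc n) x
  Q2 = qint (suc (suc n)) x
  l0 : ∀ y → - y * - y ≡ y * y
  l0 = solve-∀
  l1 : ∀ y Q1 Q2 → (+ 1 + y) * Q1 * ((+ 1 + - y) * Q2) ≡ Q1 * (Q2 - y * y * Q2)
  l1 = solve-∀
  l2 : ∀ x Q1 Q2 → Q1 * (Q2 - x * Q2) ≡ Q1 * - ((x - + 1) * Q2)
  l2 = solve-∀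
  l3 : ∀ Q X → Q * - (X - + 1) ≡ Q * (+ 1 - X)
  l3 = solve-∀

absSignFmajGF-closed : ∀ q n → absSignFmajGF q n ≡ prodQ n (altSign⁻ q)
absSignFmajGF-closed q zero = refl
absSignFmajGF-closed q (suc zero) rewrite ℤP.neg-involutive q = l q
  where l : ∀ q → + 1 * (q * + 1) + (+ 1 * + 1 + + 0) ≡ + 1 * (+ 1 + (q * + 1 + + 0))
        l = solve-∀
absSignFmajGF-closed q (suc (suc n)) = begin
  absSignFmajGF q (suc (suc n))                         ≡⟨ absSignFmajGF-suc² q n ⟩
  TwoLetters.K q n * absSignFmajGF q n                  ≡⟨ cong₂ _*_ K≡ (absSignFmajGF-closed q n) ⟩
  qint (2 ℕ.* suc n) q₁ * qint (2 ℕ.* suc (suc n)) q₂ * prodQ n (altSign⁻ q) ≡⟨ lemma (qint (2 ℕ.* suc n) q₁) (qint (2 ℕ.* suc (suc n)) q₂) (prodQ n (altSign⁻ q)) ⟩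
  prodQ (suc (suc n)) (altSign⁻ q)                         ∎
  where
  open ≡-Reasoning
  q₁ = altSign⁻ q (suc n)
  q₂ = altSign⁻ q (suc (suc n))
  K≡ : TwoLetters.K q n ≡ qint (2 ℕ.* suc n) q₁ * qint (2 ℕ.* suc (suc n)) q₂
  K≡ = sym (trans (cong (λ t → qint (2 ℕ.* suc n) q₁ * qint (2 ℕ.* suc (suc n)) t) (altSign⁻-suc² q n))
                  (qint-consecutive q₁ (q * q) n (altSign⁻-square q (suc n))))
  lemma : ∀ a b p → a * b * p ≡ p * a * b
  lemma = solve-∀

indicator : Bool → ℕ
indicator b = if b then 1 else 0

countBelow-∷ : ∀ x y r → countBelow x (y ∷ r) ≡ indicator (y ℕ.<ᵇ x) ℕ.+ countBelow x r
countBelow-∷ x y r with y ℕ.<ᵇ x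
... | true = refl
... | false = refl

swapAtᴺ : ℕ → List ℕ → List ℕ
swapAtᴺ zero (x ∷ y ∷ xs) = y ∷ x ∷ xs
swapAtᴺ (suc i) (x ∷ xs) = x ∷ swapAtᴺ i xs
swapAtᴺ _ xs = xs

map-swapAt : ∀ j l → map ∣_∣ (swapAt j l) ≡ swapAtᴺ j (map ∣_∣ l)
map-swapAt zero [] = refl
map-swapAt zero (x ∷ []) = refl
map-swapAt zero (x ∷ y ∷ l) = refl
map-swapAt (suc j) [] = refl
map-swapAt (suc j) (x ∷ l) = cong (∣ x ∣ ∷_) (map-swapAt j l)

swapAt-All : ∀ {P : ℤ → Set} j l → All P l → All P (swapAt j l)
swapAt-All zero [] p = p
swapAt-All zero (x ∷ []) p = p
swapAt-All zero (x ∷ y ∷ l) (px ∷ py ∷ pl) = py ∷ px ∷ pl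
swapAt-All (suc j) [] p = p
swapAt-All (suc j) (x ∷ l) (px ∷ pl) = px ∷ swapAt-All j l pl

swapAtᴺ-All : ∀ {P : ℕ → Set} j l → All P l → All P (swapAtᴺ j l)
swapAtᴺ-All zero [] p = p
swapAtᴺ-All zero (x ∷ []) p = p
swapAtᴺ-All zero (x ∷ y ∷ l) (px ∷ py ∷ pl) = py ∷ px ∷ pl
swapAtᴺ-All (suc j) [] p = p
swapAtᴺ-All (suc j) (x ∷ l) (px ∷ pl) = px ∷ swapAtᴺ-All j l pl

length-swapAt : ∀ j l → length (swapAt j l) ≡ length l
length-swapAt zero [] = refl
length-swapAt zero (x ∷ []) = refl
length-swapAt zero (x ∷ y ∷ l) = refl
length-swapAt (suc j) [] = refl
length-swapAt (suc j) (x ∷ l) = cong suc (length-swapAt j l)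

neg-swapAt : ∀ j l → neg (swapAt j l) ≡ neg l
neg-swapAt zero [] = refl
neg-swapAt zero (x ∷ []) = refl
neg-swapAt zero (+ a ∷ + b ∷ l) = refl
neg-swapAt zero (+ a ∷ -[1+ b ] ∷ l) = refl
neg-swapAt zero (-[1+ a ] ∷ + b ∷ l) = refl
neg-swapAt zero (-[1+ a ] ∷ -[1+ b ] ∷ l) = refl
neg-swapAt (suc j) [] = refl
neg-swapAt (suc j) (+ a ∷ l) = neg-swapAt j l
neg-swapAt (suc j) (-[1+ a ] ∷ l) = cong suc (neg-swapAt j l)

countBelow-swapAtᴺ : ∀ x j l → countBelow x (swapAtᴺ j l) ≡ countBelow x l
countBelow-swapAtᴺ x zero [] = refl
countBelow-swapAtᴺ x zero (a ∷ []) = refl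
countBelow-swapAtᴺ x zero (a ∷ b ∷ l) rewrite countBelow-∷ x b (a ∷ l) | countBelow-∷ x a l | countBelow-∷ x a (b ∷ l) | countBelow-∷ x b l =
  trans (sym (ℕP.+-assoc (indicator (b ℕ.<ᵇ x)) _ _)) (trans (cong (ℕ._+ countBelow x l) (ℕP.+-comm (indicator (b ℕ.<ᵇ x)) _)) (ℕP.+-assoc (indicator (a ℕ.<ᵇ x)) _ _))
countBelow-swapAtᴺ x (suc j) [] = refl
countBelow-swapAtᴺ x (suc j) (a ∷ l) rewrite countBelow-∷ x a (swapAtᴺ j l) | countBelow-∷ x a l = cong (indicator (a ℕ.<ᵇ x) ℕ.+_) (countBelow-swapAtᴺ x j l)

swapAtᴺ-Unique : ∀ j l → Unique l → Unique (swapAtᴺ j l)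
swapAtᴺ-Unique zero [] u = u
swapAtᴺ-Unique zero (x ∷ []) u = u
swapAtᴺ-Unique zero (x ∷ y ∷ l) ((xy ∷ xl) ∷ (yl ∷ ul)) = ((λ e → xy (sym e)) ∷ yl) ∷ (xl ∷ ul)
swapAtᴺ-Unique (suc j) [] u = u
swapAtᴺ-Unique (suc j) (x ∷ l) (xl ∷ ul) = swapAtᴺ-All j l xl ∷ swapAtᴺ-Unique j l ul

inv-swapAtᴺ : ∀ j l → Unique l → suc j < length l → -1^ (inv (swapAtᴺ j l)) ≡ - -1^ (inv l)
inv-swapAtᴺ zero [] u ()
inv-swapAtᴺ zero (a ∷ []) u (ℕ.s≤s ())
inv-swapAtᴺ zero (a ∷ b ∷ r) ((a≢b ∷ _) ∷ _) _ rewrite countBelow-∷ b a r | countBelow-∷ a b r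
  with a ℕ.<ᵇ b in a<b | b ℕ.<ᵇ a in b<a
... | true | true = ⊥-elim (false≢true (trans (sym (<ᵇ-asym a b a<b)) b<a))
... | false | false = ⊥-elim (Sum.[ (λ a<b′ → false≢true (trans (sym a<b) a<b′)) , (λ b<a′ → false≢true (trans (sym b<a) b<a′)) ] (<ᵇ-tri a b a≢b))
... | true | false =
  trans (cong (λ k → -1^ (suc k)) (x∙yz≈y∙xz (countBelow b r) (countBelow a r) (inv r))) (-1^-suc (countBelow a r ℕ.+ (countBelow b r ℕ.+ inv r)))
... | false | true =
  trans (cong -1^_ (x∙yz≈y∙xz (countBelow b r) (countBelow a r) (inv r)))
    (trans (sym (ℤP.neg-involutive _)) (cong -_ (sym (-1^-suc (countBelow a r ℕ.+ (countBelow b r ℕ.+ inv r))))))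
inv-swapAtᴺ (suc j) [] u ()
inv-swapAtᴺ (suc j) (a ∷ l) (_ ∷ ul) (ℕ.s≤s lt) =
  trans (cong (λ c → -1^ (c ℕ.+ inv (swapAtᴺ j l))) (countBelow-swapAtᴺ a j l))
    (trans (-1^-+ (countBelow a l) (inv (swapAtᴺ j l)))
      (trans (cong (-1^ (countBelow a l) *_) (inv-swapAtᴺ j l ul lt))
        (trans (sym (ℤP.neg-distribʳ-* (-1^ (countBelow a l)) (-1^ (inv l)))) (cong -_ (sym (-1^-+ (countBelow a l) (inv l)))))))

SignedPerm : ℕ → List ℤ → Set
SignedPerm n σ = length σ ≡ n × Unique (map ∣_∣ σ) × All (λ z → ¬ z ≡ + 0) σ

invNeg : List ℤ → ℕ
invNeg σ = inv (map ∣_∣ σ) ℕ.+ neg σ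

applyGen-parity : ∀ n i σ → i < n → SignedPerm n σ → SignedPerm n (applyGen i σ) × -1^ (invNeg (applyGen i σ)) ≡ - -1^ (invNeg σ)
applyGen-parity n zero [] lt (refl , _) = ⊥-elim (ℕP.n≮0 lt)
applyGen-parity n zero (+ zero ∷ xs) lt (l , u , (nz ∷ _)) = ⊥-elim (nz refl)
applyGen-parity n zero (+ suc k ∷ xs) lt (l , u , (_ ∷ az)) = (l , u , ((λ ()) ∷ az)) ,
  trans (cong -1^_ (ℕP.+-suc (inv (suc k ∷ map ∣_∣ xs)) (neg xs))) (-1^-suc (inv (suc k ∷ map ∣_∣ xs) ℕ.+ neg xs))
applyGen-parity n zero (-[1+ k ] ∷ xs) lt (l , u , (_ ∷ az)) = (l , u , ((λ ()) ∷ az)) ,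
  sym (trans (cong (λ t → - -1^ t) (ℕP.+-suc (inv (suc k ∷ map ∣_∣ xs)) (neg xs))) (trans (cong -_ (-1^-suc (inv (suc k ∷ map ∣_∣ xs) ℕ.+ neg xs))) (ℤP.neg-involutive (-1^ (inv (suc k ∷ map ∣_∣ xs) ℕ.+ neg xs)))))
applyGen-parity n (suc j) σ lt (l , u , az) =
  (trans (length-swapAt j σ) l , subst Unique (sym (map-swapAt j σ)) (swapAtᴺ-Unique j (map ∣_∣ σ) u) , swapAt-All j σ az) ,
  (begin
    -1^ (inv (map ∣_∣ (swapAt j σ)) ℕ.+ neg (swapAt j σ)) ≡⟨ cong₂ (λ a b → -1^ (inv a ℕ.+ b)) (map-swapAt j σ) (neg-swapAt j σ) ⟩
    -1^ (inv (swapAtᴺ j (map ∣_∣ σ)) ℕ.+ neg σ) ≡⟨ -1^-+ (inv (swapAtᴺ j (map ∣_∣ σ))) (neg σ) ⟩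
    -1^ (inv (swapAtᴺ j (map ∣_∣ σ))) * -1^ (neg σ) ≡⟨ cong (_* -1^ (neg σ)) (inv-swapAtᴺ j (map ∣_∣ σ) u (subst (suc j <_) (sym (trans (LP.length-map ∣_∣ σ) l)) lt)) ⟩
    - -1^ (inv (map ∣_∣ σ)) * -1^ (neg σ) ≡⟨ sym (ℤP.neg-distribˡ-* (-1^ (inv (map ∣_∣ σ))) (-1^ (neg σ))) ⟩
    - (-1^ (inv (map ∣_∣ σ)) * -1^ (neg σ)) ≡⟨ cong -_ (sym (-1^-+ (inv (map ∣_∣ σ)) (neg σ))) ⟩
    - -1^ (invNeg σ) ∎)
  where open ≡-Reasoning

wordProd-parity : ∀ n w σ → SignedPerm n σ → All (_< n) w → -1^ (length w) * -1^ (invNeg σ) ≡ -1^ (invNeg (foldl (λ σ i → applyGen i σ) σ w))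
wordProd-parity n [] σ v _ = ℤP.*-identityˡ (-1^ (invNeg σ))
wordProd-parity n (i ∷ w) σ v (lt ∷ aw) with applyGen-parity n i σ lt v
... | v' , e = begin
    -1^ (suc (length w)) * -1^ (invNeg σ) ≡⟨ cong (_* -1^ (invNeg σ)) (-1^-suc (length w)) ⟩
    - -1^ (length w) * -1^ (invNeg σ) ≡⟨ l (-1^ (length w)) (-1^ (invNeg σ)) ⟩
    -1^ (length w) * - -1^ (invNeg σ) ≡⟨ cong (-1^ (length w) *_) (sym e) ⟩
    -1^ (length w) * -1^ (invNeg (applyGen i σ)) ≡⟨ wordProd-parity n w (applyGen i σ) v' aw ⟩
    -1^ (invNeg (foldl (λ σ i → applyGen i σ) (applyGen i σ) w)) ∎
  where
  open ≡-Reasoning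
  l : ∀ a b → - a * b ≡ a * - b
  l = solve-∀

applyUpTo-Unique : ∀ n (f : ℕ → ℕ) → (∀ i j → f i ≡ f j → i ≡ j) → Unique (applyUpTo f n)
applyUpTo-Unique zero f inj = []
applyUpTo-Unique (suc n) f inj = AllP.applyUpTo⁺₂ (f ∘ suc) n (λ i e → ℕP.0≢1+n (inj 0 (suc i) e)) ∷ applyUpTo-Unique n (f ∘ suc) (λ i j e → ℕP.suc-injective (inj (suc i) (suc j) e))

countBelow-none : ∀ x l → All (λ y → (y ℕ.<ᵇ x) ≡ false) l → countBelow x l ≡ 0
countBelow-none x [] [] = refl
countBelow-none x (y ∷ l) (p ∷ ps) rewrite countBelow-∷ x y l | p = countBelow-none x l ps

inv-increasing : ∀ n (f : ℕ → ℕ) → (∀ i j → i < j → f i < f j) → inv (applyUpTo f n) ≡ 0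
inv-increasing zero f m = refl
inv-increasing (suc n) f m = cong₂ ℕ._+_ (countBelow-none (f 0) _ (AllP.applyUpTo⁺₂ (f ∘ suc) n (λ i → <ᵇ-asym (f 0) (f (suc i)) (T⇒≡true (ℕP.<⇒<ᵇ (m 0 (suc i) (ℕ.s≤s ℕ.z≤n)))))))
                                (inv-increasing n (f ∘ suc) (λ i j lt → m (suc i) (suc j) (ℕ.s≤s lt)))

neg-positive : ∀ l → neg (map (λ i → + suc i) l) ≡ 0
neg-positive [] = refl
neg-positive (i ∷ l) = neg-positive l

map-∣∣-idPerm : ∀ n → map ∣_∣ (idPerm n) ≡ applyUpTo suc n
map-∣∣-idPerm n = trans (sym (LP.map-∘ (upTo n))) (LP.map-upTo suc n)

idPerm-SignedPerm : ∀ n → SignedPerm n (idPerm n)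
idPerm-SignedPerm n = trans (LP.length-map _ (upTo n)) (LP.length-upTo n) ,
            subst Unique (sym (map-∣∣-idPerm n)) (applyUpTo-Unique n suc (λ i j → ℕP.suc-injective)) ,
            AllP.map⁺ (All.universal (λ i → λ ()) (upTo n))

invNeg-idPerm : ∀ n → invNeg (idPerm n) ≡ 0
invNeg-idPerm n = cong₂ ℕ._+_ (trans (cong inv (map-∣∣-idPerm n)) (inv-increasing n suc (λ i j lt → ℕ.s≤s lt))) (neg-positive (upTo n))

-1^-isEven : ∀ a b → -1^ a ≡ -1^ b → isEven a ≡ isEven b
-1^-isEven a b e with isEven a | isEven b
... | true | true = refl
... | false | false = refl
... | true | false with e
...   | ()
-1^-isEven a b e | false | true with e
...   | ()

isLength-parity : ∀ n σ k → IsLength n σ k → isEven k ≡ isEven (invNeg σ)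
isLength-parity n σ k ((w , aw , lw , pw) , _) = -1^-isEven k (invNeg σ) (begin
    -1^ k ≡⟨ cong -1^_ (sym lw) ⟩
    -1^ (length w) ≡⟨ sym (ℤP.*-identityʳ (-1^ (length w))) ⟩
    -1^ (length w) * -1^ 0 ≡⟨ cong (λ t → -1^ (length w) * -1^ t) (sym (invNeg-idPerm n)) ⟩
    -1^ (length w) * -1^ (invNeg (idPerm n)) ≡⟨ wordProd-parity n w (idPerm n) (idPerm-SignedPerm n) aw ⟩
    -1^ (invNeg (wordProd n w)) ≡⟨ cong (λ t → -1^ (invNeg t)) pw ⟩
    -1^ (invNeg σ) ∎)
  where open ≡-Reasoning

fmajSum-double : ∀ q (P : List ℤ → Bool) xs → + 2 * fmajSum q P xs ≡ ∑ (λ σ → q ^ᶻ fmaj σ) xs + ∑ (λ σ → (if P σ then + 1 else - + 1) * q ^ᶻ fmaj σ) xs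
fmajSum-double q P xs = trans (sym (∑-scale (+ 2) (λ σ → if P σ then q ^ᶻ fmaj σ else + 0) xs))
                 (trans (∑-cong pointwise xs) (∑-+ (λ σ → q ^ᶻ fmaj σ) (λ σ → (if P σ then + 1 else - + 1) * q ^ᶻ fmaj σ) xs))
  where
  pointwise : ∀ σ → + 2 * (if P σ then q ^ᶻ fmaj σ else + 0) ≡ q ^ᶻ fmaj σ + (if P σ then + 1 else - + 1) * q ^ᶻ fmaj σ
  pointwise σ with P σ
  ... | true = l (q ^ᶻ fmaj σ)
    where l : ∀ v → + 2 * v ≡ v + + 1 * v
          l = solve-∀
  ... | false = l (q ^ᶻ fmaj σ)
    where l : ∀ v → + 2 * + 0 ≡ v + - + 1 * v
          l = solve-∀

∑-cong-∈ : {A : Set} {f g : A → ℤ} (xs : List A) → (∀ x → x ∈ xs → f x ≡ g x) → ∑ f xs ≡ ∑ g xs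
∑-cong-∈ [] e = refl
∑-cong-∈ (x ∷ xs) e = cong₂ _+_ (e x (here refl)) (∑-cong-∈ xs (λ y m → e y (there m)))

prodQ-cong : ∀ n {f g : ℕ → ℤ} → (∀ i → f i ≡ g i) → prodQ n f ≡ prodQ n g
prodQ-cong zero e = refl
prodQ-cong (suc n) e = cong₂ (λ a b → a * qint (2 ℕ.* suc n) b) (prodQ-cong n e) (e (suc n))

-1^-double : ∀ k → -1^ (2 ℕ.* k) ≡ + 1
-1^-double k = trans (-1^-+ k (k ℕ.+ 0)) (trans (cong (λ t → -1^ k * -1^ t) (ℕP.+-identityʳ k)) (-1^-square k))

-1^neg*q^fmaj : ∀ q σ → -1^ (neg σ) * q ^ᶻ fmaj σ ≡ (- q) ^ᶻ fmaj σ
-1^neg*q^fmaj q σ = sym (begin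
  (- q) ^ᶻ fmaj σ                                   ≡⟨ neg-^ᶻ q (fmaj σ) ⟩
  -1^ (2 ℕ.* maj σ ℕ.+ neg σ) * q ^ᶻ fmaj σ         ≡⟨ cong (_* q ^ᶻ fmaj σ) (-1^-+ (2 ℕ.* maj σ) (neg σ)) ⟩
  -1^ (2 ℕ.* maj σ) * -1^ (neg σ) * q ^ᶻ fmaj σ     ≡⟨ cong (λ t → t * -1^ (neg σ) * q ^ᶻ fmaj σ) (-1^-double (maj σ)) ⟩
  + 1 * -1^ (neg σ) * q ^ᶻ fmaj σ                   ≡⟨ cong (_* q ^ᶻ fmaj σ) (ℤP.*-identityˡ (-1^ (neg σ))) ⟩
  -1^ (neg σ) * q ^ᶻ fmaj σ                         ∎)
  where open ≡-Reasoning

altSign⁻-neg : ∀ q i → altSign⁻ (- q) i ≡ altSign i q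
altSign⁻-neg q i with isEven i
... | true = ℤP.neg-involutive q
... | false = ℤP.neg-involutive (- q)

lengthSign*q^fmaj : ∀ n σ k q → IsLength n σ k →
  (if isEven k then + 1 else - + 1) * q ^ᶻ fmaj σ ≡ absSign σ * (- q) ^ᶻ fmaj σ
lengthSign*q^fmaj n σ k q σ-length = begin
  -1^ k * q ^ᶻ fmaj σ                      ≡⟨ cong (λ b → (if b then + 1 else - + 1) * q ^ᶻ fmaj σ) (isLength-parity n σ k σ-length) ⟩
  -1^ (invNeg σ) * q ^ᶻ fmaj σ             ≡⟨ cong (_* q ^ᶻ fmaj σ) (-1^-+ (inv (map ∣_∣ σ)) (neg σ)) ⟩
  absSign σ * -1^ (neg σ) * q ^ᶻ fmaj σ    ≡⟨ ℤP.*-assoc (absSign σ) (-1^ (neg σ)) (q ^ᶻ fmaj σ) ⟩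
  absSign σ * (-1^ (neg σ) * q ^ᶻ fmaj σ)  ≡⟨ cong (absSign σ *_) (-1^neg*q^fmaj q σ) ⟩
  absSign σ * (- q) ^ᶻ fmaj σ              ∎
  where open ≡-Reasoning

corollary7p2 : (n : ℕ) (ℓ : List ℤ → ℕ) →
    ((σ : List ℤ) → σ ∈ Bn n → IsLength n σ (ℓ σ)) →
    (q : ℤ) →
    (+ 2 * fmajSum q (λ σ → isEven (ℓ σ)) (Bn n)
    ≡ prodQ n (λ _ → q) + prodQ n (λ i → altSign i q))
    × (+ 2 * fmajSum q (λ σ → isEven (neg σ)) (Bn n)
    ≡ prodQ n (λ _ → q) + prodQ n (λ _ → - q))
    × (+ 2 * fmajSum q (λ σ → isEven (inv (map ∣_∣ σ))) (Bn n)
    ≡ prodQ n (λ _ → q) + prodQ n (λ i → - altSign i q))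
corollary7p2 n ℓ ℓ-isLength q =
    half (trans (∑-cong-∈ (Bn n) (λ σ σ∈Bn → lengthSign*q^fmaj n σ (ℓ σ) q (ℓ-isLength σ σ∈Bn)))
                (trans (absSignFmajGF-closed (- q) n) (prodQ-cong n (altSign⁻-neg q))))
  , half (trans (∑-cong (-1^neg*q^fmaj q) (Bn n)) (fmajGF-closed (- q) n))
  , half (absSignFmajGF-closed q n)
  where
  half : ∀ {P : List ℤ → Bool} {Π} → ∑ (λ σ → (if P σ then + 1 else - + 1) * q ^ᶻ fmaj σ) (Bn n) ≡ Π →
         + 2 * fmajSum q P (Bn n) ≡ prodQ n (λ _ → q) + Π
  half {P} signed = trans (fmajSum-double q P (Bn n)) (cong₂ _+_ (fmajGF-closed q n) signed)
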